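{- Let $1\le k\le n$ and let $[\mu]$ be a cyclic composition of $n$ into $k$ parts. Then the number of Dyck paths of semilength $n$ whose rise composition lies in $[\mu]$ equals $\frac{\mathsf{ord}[\mu]}{k}\binom{n}{k-1}$.
   Context: A Dyck path of semilength $n$ is a word in the letters $U,D$ with $n$ copies of each letter such that no prefix contains more $D$'s than $U$'s. A Dyck word with exactly $k$ occurrences of the factor $UD$ can be written uniquely as $U^{a_1}D^{b_1}\cdots U^{a_k}D^{b_k}$ with all $a_i,b_i\ge1$; $(a_1,\dots,a_k)$ is its rise composition. A cyclic composition $[\mu]$ is the equivalence class of a composition $\mu$ (sequence of positive integers) under cyclic shift, and $\mathsf{ord}[\mu]$ is the number of distinct compositions in this class. -}

module Defs where

open import Data.Nat using (ℕ; zero; suc; _+_; _*_; _∸_; _≤_; _<_)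
open import Data.Nat.Properties using (_≟_)
open import Data.Bool using (Bool; true; false; _∧_)
open import Data.List using (List; []; _∷_; _++_; length; filter; map; concatMap; drop; take; upTo; deduplicate; any)
open import Data.List.Relation.Unary.All using (All)
open import Data.List.Relation.Unary.Any using (Any)
open import Data.List.Properties using (≡-dec)
open import Data.Nat.ListAction using (sum)
open import Data.Product using (_×_; _,_; Σ)
open import Relation.Nullary using (Dec; yes; no; does)
open import Relation.Binary.PropositionalEquality using (_≡_)

data Step : Set where
  U D : Step

words : ℕ → List (List Step)
words zero    = [] ∷ []
words (suc m) = map (U ∷_) (words m) ++ map (D ∷_) (words m)

-- Dyck check: h is current height (#U - #D of the prefix read so far);
-- no prefix may go below 0, and the whole word must end at height 0.
dyckFrom : ℕ → List Step → Bool
dyckFrom zero    []      = true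
dyckFrom (suc _) []      = false
dyckFrom h       (U ∷ w) = dyckFrom (suc h) w
dyckFrom zero    (D ∷ w) = false
dyckFrom (suc h) (D ∷ w) = dyckFrom h w

isDyck : List Step → Bool
isDyck = dyckFrom 0

dyckPaths : ℕ → List (List Step)
dyckPaths n = filter (λ w → Relation.Nullary.Decidable.T? (isDyck w)) (words (n + n))
  where import Relation.Nullary.Decidable

-- Rise composition: writing the word as U^{a1} D^{b1} ... U^{ak} D^{bk},
-- it is (a1,...,ak), i.e. the lengths of the maximal runs of U's.
-- riseAux c w : c is the length of the U-run currently being read.
riseAux : ℕ → List Step → List ℕ
riseAux zero    []      = []
riseAux (suc c) []      = suc c ∷ []
riseAux c       (U ∷ w) = riseAux (suc c) w
riseAux zero    (D ∷ w) = riseAux zero w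
riseAux (suc c) (D ∷ w) = suc c ∷ riseAux zero w

riseComposition : List Step → List ℕ
riseComposition = riseAux 0

rotate : ℕ → List ℕ → List ℕ
rotate i μ = drop i μ ++ take i μ

rotations : List ℕ → List (List ℕ)
rotations μ = map (λ i → rotate i μ) (upTo (length μ))

_∈Cyc_ : List ℕ → List ℕ → Set
ν ∈Cyc μ = Any (ν ≡_) (rotations μ)

ord : List ℕ → ℕ
ord μ = length (deduplicate (≡-dec _≟_) (rotations μ))

IsComposition : ℕ → ℕ → List ℕ → Set
IsComposition n k μ = All (1 ≤_) μ × (sum μ ≡ n) × (length μ ≡ k)

_∈Cyc?_ : (ν μ : List ℕ) → Dec (ν ∈Cyc μ)
ν ∈Cyc? μ = Data.List.Relation.Unary.Any.any? (λ ρ → ≡-dec _≟_ ν ρ) (rotations μ)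
  where import Data.List.Relation.Unary.Any

countCyc : ℕ → List ℕ → ℕ
countCyc n μ = length (filter (λ w → riseComposition w ∈Cyc? μ) (dyckPaths n))

-- A word U^a₁ D^b₁ ⋯ U^aₖ D^bₖ is determined by its rise composition a and descent composition b, and
-- it is a Dyck path iff the partial sums of a − b are nonnegative and the total is 0. Adding 1 to the last
-- descent turns b into a composition c of n + 1 and a − c into a sequence with sum −1, whose proper
-- partial sums must be nonnegative. By the cycle lemma exactly one of the k simultaneous rotations of
-- (a, c) has this property, so summing the number of Dyck paths with rise composition ν over the k
-- rotations ν of μ counts every composition of n + 1 into k parts once: binom(n, k − 1) by stars and
-- bars. Among these k rotations each member of [μ] occurs k / ord[μ] times.

module Submission where

open import Defs
open import Data.Nat using (ℕ; zero; suc; _+_; _*_; _∸_; _⊓_; _≤_; _<_; z≤n; s≤s; _≤?_; _<?_)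
open import Data.Nat.Properties
open import Data.Nat.Combinatorics using (_C_; nCk+nC[k+1]≡[n+1]C[k+1])
open import Data.Nat.ListAction using (sum)
open import Data.Nat.ListAction.Properties using (sum-++)
open import Data.Nat.Tactic.RingSolver using (solve-∀)
open import Data.Integer as ℤ using (ℤ; _⊖_; 0ℤ; -1ℤ; pred) renaming (+_ to pos)
import Data.Integer.Properties as ℤ
import Data.Integer.Tactic.RingSolver as ℤ-Solver
open import Data.Bool using (Bool; true; false; _∧_; T)
open import Data.Bool.Properties using (T-∧)
open import Data.List using (List; []; _∷_; _++_; [_]; length; filter; map; replicate; take; drop; zipWith; applyUpTo; upTo; deduplicate)
open import Data.List.Properties using (≡-dec; length-++; length-drop; length-map; length-replicate; length-upTo; take++drop≡id; ++-assoc; ++-identityʳ; drop-all; take-all; take-take; take-[]; zipWith-zeroʳ)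
open import Data.List.Membership.Propositional using (_∈_; _∉_)
open import Data.List.Membership.Propositional.Properties using (∈-map⁻; ∈-upTo⁻; ∈-deduplicate⁺; ∈-deduplicate⁻)
open import Data.List.Relation.Unary.All as All using (All; []; _∷_)
open import Data.List.Relation.Unary.All.Properties using (++⁺; map⁺; drop⁺; take⁺; All¬⇒¬Any)
open import Data.List.Relation.Unary.Any using (here; there)
open import Data.List.Relation.Unary.AllPairs using ([]; _∷_)
open import Data.List.Relation.Unary.Unique.Propositional using (Unique)
open import Data.List.Relation.Unary.Unique.DecPropositional.Properties using (deduplicate-!)
open import Data.Product using (_×_; _,_; proj₁; proj₂; Σ-syntax; ∃-syntax; ∃₂)
open import Data.Sum using (inj₁; inj₂)
open import Data.Empty using (⊥; ⊥-elim)
open import Function using (Equivalence; _∘′_)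
open import Level using (0ℓ)
open import Relation.Nullary using (Dec; yes; no; does; ¬_)
open import Relation.Nullary.Decidable using (T?)
open import Relation.Unary using (Pred)
import Relation.Unary as U
open import Relation.Binary.Definitions using (DecidableEquality; tri<; tri≈; tri>)
open import Relation.Binary.PropositionalEquality hiding ([_])
open ≡-Reasoning

𝟙 : Bool → ℕ
𝟙 true  = 1
𝟙 false = 0

𝟙-∧ : ∀ a b → 𝟙 (a ∧ b) ≡ 𝟙 a * 𝟙 b
𝟙-∧ true  b = sym (+-identityʳ (𝟙 b))
𝟙-∧ false b = refl

𝟙-cong : ∀ {a b} → (T a → T b) → (T b → T a) → 𝟙 a ≡ 𝟙 b
𝟙-cong {true}  {true}  _ _ = refl
𝟙-cong {true}  {false} f _ = ⊥-elim (f _)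
𝟙-cong {false} {true}  _ g = ⊥-elim (g _)
𝟙-cong {false} {false} _ _ = refl

𝟙-T : ∀ {b} → T b → 𝟙 b ≡ 1
𝟙-T {true} _ = refl

𝟙-¬T : ∀ {b} → ¬ T b → 𝟙 b ≡ 0
𝟙-¬T {true}  ¬b = ⊥-elim (¬b _)
𝟙-¬T {false} _  = refl

∧-intro : ∀ {a b} → T a → T b → T (a ∧ b)
∧-intro ta tb = Equivalence.from T-∧ (ta , tb)

∧-elim : ∀ {a b} → T (a ∧ b) → T a × T b
∧-elim = Equivalence.to T-∧

module _ {P : Set} where

  T-does⁺ : (d : Dec P) → P → T (does d)
  T-does⁺ (yes _) _ = _
  T-does⁺ (no ¬p) p = ¬p p

  T-does⁻ : (d : Dec P) → T (does d) → P
  T-does⁻ (yes p) _ = p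

∑ : {A : Set} → List A → (A → ℕ) → ℕ
∑ []       f = 0
∑ (x ∷ xs) f = f x + ∑ xs f

infix 6.5 ∑
syntax ∑ xs (λ x → e) = ∑[ x ∈ xs ] e

module _ {A : Set} where

  ∑-++ : (xs ys : List A) (f : A → ℕ) → ∑ (xs ++ ys) f ≡ ∑ xs f + ∑ ys f
  ∑-++ []       ys f = refl
  ∑-++ (x ∷ xs) ys f = trans (cong (f x +_) (∑-++ xs ys f)) (sym (+-assoc (f x) _ _))

  ∑-cong : (xs : List A) {f g : A → ℕ} → (∀ {x} → x ∈ xs → f x ≡ g x) → ∑ xs f ≡ ∑ xs g
  ∑-cong []       f≡g = refl
  ∑-cong (x ∷ xs) f≡g = cong₂ _+_ (f≡g (here refl)) (∑-cong xs (f≡g ∘′ there))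

  ∑-const : (xs : List A) (c : ℕ) → ∑[ x ∈ xs ] c ≡ length xs * c
  ∑-const []       c = refl
  ∑-const (x ∷ xs) c = cong (c +_) (∑-const xs c)

  ∑-zero : (xs : List A) {f : A → ℕ} → (∀ {x} → x ∈ xs → f x ≡ 0) → ∑ xs f ≡ 0
  ∑-zero []       f≡0 = refl
  ∑-zero (x ∷ xs) f≡0 = cong₂ _+_ (f≡0 (here refl)) (∑-zero xs (f≡0 ∘′ there))

  ∑-*ˡ : (c : ℕ) (xs : List A) (f : A → ℕ) → c * ∑ xs f ≡ ∑[ x ∈ xs ] c * f x
  ∑-*ˡ c []       f = *-zeroʳ c
  ∑-*ˡ c (x ∷ xs) f = trans (*-distribˡ-+ c (f x) _) (cong (c * f x +_) (∑-*ˡ c xs f))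

  ∑-scale : (c d : ℕ) (xs : List A) {f g : A → ℕ} → (∀ {x} → x ∈ xs → c * f x ≡ d * g x) → c * ∑ xs f ≡ d * ∑ xs g
  ∑-scale c d xs {f} {g} cf≡dg = trans (∑-*ˡ c xs f) (trans (∑-cong xs cf≡dg) (sym (∑-*ˡ d xs g)))

  ∑-+ : (xs : List A) (f g : A → ℕ) → ∑[ x ∈ xs ] (f x + g x) ≡ ∑ xs f + ∑ xs g
  ∑-+ []       f g = refl
  ∑-+ (x ∷ xs) f g = trans (cong (f x + g x +_) (∑-+ xs f g)) (interchange (f x) (g x) _ _)
    where
    interchange : ∀ a b c d → a + b + (c + d) ≡ a + c + (b + d)
    interchange = solve-∀

  ∑-filter : {P : Pred A 0ℓ} (P? : U.Decidable P) (xs : List A) (f : A → ℕ) →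
             ∑ (filter P? xs) f ≡ ∑[ x ∈ xs ] 𝟙 (does (P? x)) * f x
  ∑-filter P? []       f = refl
  ∑-filter P? (x ∷ xs) f with does (P? x)
  ... | true  = cong₂ _+_ (sym (+-identityʳ (f x))) (∑-filter P? xs f)
  ... | false = ∑-filter P? xs f

  length-filter≡∑ : {P : Pred A 0ℓ} (P? : U.Decidable P) (xs : List A) →
                    length (filter P? xs) ≡ ∑[ x ∈ xs ] 𝟙 (does (P? x))
  length-filter≡∑ P? []       = refl
  length-filter≡∑ P? (x ∷ xs) with does (P? x)
  ... | true  = cong suc (length-filter≡∑ P? xs)
  ... | false = length-filter≡∑ P? xs

module _ {A B : Set} where

  ∑-map : (g : A → B) (xs : List A) (f : B → ℕ) → ∑ (map g xs) f ≡ ∑[ x ∈ xs ] f (g x)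
  ∑-map g []       f = refl
  ∑-map g (x ∷ xs) f = cong (f (g x) +_) (∑-map g xs f)

  ∑-comm : (xs : List A) (ys : List B) (F : A → B → ℕ) →
           ∑[ x ∈ xs ] ∑[ y ∈ ys ] F x y ≡ ∑[ y ∈ ys ] ∑[ x ∈ xs ] F x y
  ∑-comm []       ys F = sym (∑-zero ys (λ _ → refl))
  ∑-comm (x ∷ xs) ys F = trans (cong (∑ ys (F x) +_) (∑-comm xs ys F))
                               (sym (∑-+ ys (F x) (λ y → ∑[ x ∈ xs ] F x y)))

∑< : ℕ → (ℕ → ℕ) → ℕ
∑< zero    f = 0
∑< (suc k) f = ∑< k f + f k

infix 6.5 ∑<
syntax ∑< k (λ i → e) = ∑[ i < k ] e

∑<-cong : ∀ k {f g : ℕ → ℕ} → (∀ {i} → i < k → f i ≡ g i) → ∑< k f ≡ ∑< k g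
∑<-cong zero    f≡g = refl
∑<-cong (suc k) f≡g = cong₂ _+_ (∑<-cong k (f≡g ∘′ m≤n⇒m≤1+n)) (f≡g ≤-refl)

∑<-zero : ∀ k {f : ℕ → ℕ} → (∀ {i} → i < k → f i ≡ 0) → ∑< k f ≡ 0
∑<-zero zero    f≡0 = refl
∑<-zero (suc k) f≡0 = cong₂ _+_ (∑<-zero k (f≡0 ∘′ m≤n⇒m≤1+n)) (f≡0 ≤-refl)

∑<-suc : ∀ k (f : ℕ → ℕ) → ∑[ i < suc k ] f i ≡ f 0 + ∑[ i < k ] f (suc i)
∑<-suc zero    f = +-comm 0 (f 0)
∑<-suc (suc k) f = trans (cong (_+ f (suc k)) (∑<-suc k f)) (+-assoc (f 0) _ _)

∑-applyUpTo : ∀ (g : ℕ → ℕ) k (f : ℕ → ℕ) → ∑ (applyUpTo g k) f ≡ ∑[ i < k ] f (g i)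
∑-applyUpTo g zero    f = refl
∑-applyUpTo g (suc k) f = trans (cong (f (g 0) +_) (∑-applyUpTo (λ i → g (suc i)) k f))
                                (sym (∑<-suc k (λ i → f (g i))))

∑-upTo : ∀ k (f : ℕ → ℕ) → ∑ (upTo k) f ≡ ∑< k f
∑-upTo = ∑-applyUpTo (λ i → i)

∑-∑<-comm : {A : Set} (xs : List A) (k : ℕ) (F : A → ℕ → ℕ) →
            ∑[ x ∈ xs ] ∑[ i < k ] F x i ≡ ∑[ i < k ] ∑[ x ∈ xs ] F x i
∑-∑<-comm xs k F = begin
  ∑[ x ∈ xs ] ∑[ i < k ] F x i      ≡⟨ ∑-cong xs (λ {x} _ → sym (∑-upTo k (F x))) ⟩
  ∑[ x ∈ xs ] ∑[ i ∈ upTo k ] F x i ≡⟨ ∑-comm xs (upTo k) F ⟩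
  ∑[ i ∈ upTo k ] ∑[ x ∈ xs ] F x i ≡⟨ ∑-upTo k _ ⟩
  ∑[ i < k ] ∑[ x ∈ xs ] F x i      ∎

∑<-shiftˡ : ∀ k (g : ℕ → ℕ) → ∑[ i < k ] g (suc i) + g 0 ≡ ∑[ i < k ] g i + g k
∑<-shiftˡ zero    g = refl
∑<-shiftˡ (suc k) g = begin
  ∑[ i < k ] g (suc i) + g (suc k) + g 0   ≡⟨ swap-last (∑[ i < k ] g (suc i)) (g (suc k)) (g 0) ⟩
  ∑[ i < k ] g (suc i) + g 0 + g (suc k)   ≡⟨ cong (_+ g (suc k)) (∑<-shiftˡ k g) ⟩
  ∑[ i < k ] g i + g k + g (suc k)         ∎
  where
  swap-last : ∀ a b c → a + b + c ≡ a + c + b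
  swap-last = solve-∀

∑<-periodic : ∀ k (g : ℕ → ℕ) → (∀ t → g (k + t) ≡ g t) → ∀ s → ∑[ i < k ] g (s + i) ≡ ∑[ i < k ] g i
∑<-periodic k g period zero    = refl
∑<-periodic k g period (suc s) = +-cancelʳ-≡ _ _ _ (begin
  ∑[ i < k ] g (suc s + i) + g (s + 0)
    ≡⟨ cong (_+ g (s + 0)) (∑<-cong k (λ {i} _ → cong g (sym (+-suc s i)))) ⟩
  ∑[ i < k ] g (s + suc i) + g (s + 0)
    ≡⟨ ∑<-shiftˡ k (λ i → g (s + i)) ⟩
  ∑[ i < k ] g (s + i) + g (s + k)
    ≡⟨ cong₂ _+_ (∑<-periodic k g period s) (trans (cong g (+-comm s k)) (period s)) ⟩
  ∑[ i < k ] g i + g s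
    ≡⟨ cong (λ t → ∑[ i < k ] g i + g t) (sym (+-identityʳ s)) ⟩
  ∑[ i < k ] g i + g (s + 0) ∎)

∑<-𝟙-unique : ∀ k (p : ℕ → Bool) {i₀} → i₀ < k → T (p i₀) →
              (∀ {i} → i < k → T (p i) → i ≡ i₀) → ∑[ i < k ] 𝟙 (p i) ≡ 1
∑<-𝟙-unique (suc k) p {i₀} i₀<1+k pi₀ unique with i₀ ≟ k
... | yes refl = cong₂ _+_ (∑<-zero k off) (𝟙-T pi₀)
  where
  off : ∀ {i} → i < k → 𝟙 (p i) ≡ 0
  off {i} i<k = 𝟙-¬T (λ pi → <-irrefl (unique (m≤n⇒m≤1+n i<k) pi) i<k)
... | no i₀≢k = cong₂ _+_ (∑<-𝟙-unique k p (≤∧≢⇒< (≤-pred i₀<1+k) i₀≢k) pi₀ (λ i<k → unique (m≤n⇒m≤1+n i<k)))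
                          (𝟙-¬T (λ pk → i₀≢k (sym (unique ≤-refl pk))))

∑<-*ˡ : ∀ c k (f : ℕ → ℕ) → c * ∑< k f ≡ ∑[ i < k ] c * f i
∑<-*ˡ c zero    f = *-zeroʳ c
∑<-*ˡ c (suc k) f = trans (*-distribˡ-+ c _ (f k)) (cong (_+ c * f k) (∑<-*ˡ c k f))

_≟ₛ_ : DecidableEquality Step
U ≟ₛ U = yes refl
U ≟ₛ D = no (λ ())
D ≟ₛ U = no (λ ())
D ≟ₛ D = yes refl

_≟ʷ_ : DecidableEquality (List Step)
_≟ʷ_ = ≡-dec _≟ₛ_

words-length : ∀ m → All (λ w → length w ≡ m) (words m)
words-length zero    = refl ∷ []
words-length (suc m) = ++⁺ (map⁺ (All.map (cong suc) (words-length m)))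
                           (map⁺ (All.map (cong suc) (words-length m)))

∑-words-suc : ∀ m (f : List Step → ℕ) →
              ∑ (words (suc m)) f ≡ ∑[ w ∈ words m ] f (U ∷ w) + ∑[ w ∈ words m ] f (D ∷ w)
∑-words-suc m f = trans (∑-++ (map (U ∷_) (words m)) (map (D ∷_) (words m)) f)
                        (cong₂ _+_ (∑-map (U ∷_) (words m) f) (∑-map (D ∷_) (words m) f))

∑-words-𝟙≡ : ∀ m {x} → length x ≡ m → ∑[ w ∈ words m ] 𝟙 (does (w ≟ʷ x)) ≡ 1
∑-words-𝟙≡ zero    {[]}    refl = refl
∑-words-𝟙≡ (suc m) {U ∷ x} refl = trans (∑-words-suc m _) (cong₂ _+_ (∑-words-𝟙≡ m refl) (∑-zero (words m) (λ _ → refl)))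
∑-words-𝟙≡ (suc m) {D ∷ x} refl = trans (∑-words-suc m _) (cong₂ _+_ (∑-zero (words m) (λ _ → refl)) (∑-words-𝟙≡ m refl))

countWords : ℕ → (List Step → Bool) → ℕ
countWords m p = ∑[ w ∈ words m ] 𝟙 (p w)

private
  countWords-fibres : ∀ {m m'} (p : List Step → Bool) (χ : List Step → List Step) →
    (∀ {w} → length w ≡ m → T (p w) → length (χ w) ≡ m') →
    countWords m p ≡ ∑[ w ∈ words m ] ∑[ v ∈ words m' ] 𝟙 (p w ∧ does (v ≟ʷ χ w))
  countWords-fibres {m} {m'} p χ χ-length = ∑-cong (words m) fibre
    where
    fibre : ∀ {w} → w ∈ words m → 𝟙 (p w) ≡ ∑[ v ∈ words m' ] 𝟙 (p w ∧ does (v ≟ʷ χ w))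
    fibre {w} w∈ with p w in pw
    ... | true  = sym (∑-words-𝟙≡ m' (χ-length (All.lookup (words-length m) w∈) (subst T (sym pw) _)))
    ... | false = sym (∑-zero (words m') (λ _ → refl))

-- Both sides count the pairs (w, v) with w = φ v, equivalently v = ψ w.
countWords-bijection : ∀ {m m'} (p q : List Step → Bool) (φ ψ : List Step → List Step) →
  (∀ {v} → length v ≡ m' → T (q v) → T (p (φ v)) × length (φ v) ≡ m × ψ (φ v) ≡ v) →
  (∀ {w} → length w ≡ m → T (p w) → T (q (ψ w)) × length (ψ w) ≡ m' × φ (ψ w) ≡ w) →
  countWords m p ≡ countWords m' q
countWords-bijection {m} {m'} p q φ ψ φ-ok ψ-ok = begin
  countWords m p
    ≡⟨ countWords-fibres p ψ (λ lw pw → proj₁ (proj₂ (ψ-ok lw pw))) ⟩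
  ∑[ w ∈ words m ] ∑[ v ∈ words m' ] 𝟙 (p w ∧ does (v ≟ʷ ψ w))
    ≡⟨ ∑-cong (words m) (λ w∈ → ∑-cong (words m') (λ v∈ → graph-symmetric (lookup w∈) (lookup v∈))) ⟩
  ∑[ w ∈ words m ] ∑[ v ∈ words m' ] 𝟙 (q v ∧ does (w ≟ʷ φ v))
    ≡⟨ ∑-comm (words m) (words m') _ ⟩
  ∑[ v ∈ words m' ] ∑[ w ∈ words m ] 𝟙 (q v ∧ does (w ≟ʷ φ v))
    ≡⟨ countWords-fibres q φ (λ lv qv → proj₁ (proj₂ (φ-ok lv qv))) ⟨
  countWords m' q ∎
  where
  lookup : ∀ {n u} → u ∈ words n → length u ≡ n
  lookup = All.lookup (words-length _)
  graph-symmetric : ∀ {w v} → length w ≡ m → length v ≡ m' →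
                    𝟙 (p w ∧ does (v ≟ʷ ψ w)) ≡ 𝟙 (q v ∧ does (w ≟ʷ φ v))
  graph-symmetric {w} {v} lw lv = 𝟙-cong to from
    where
    to : T (p w ∧ does (v ≟ʷ ψ w)) → T (q v ∧ does (w ≟ʷ φ v))
    to pw∧v≡ψw with ∧-elim pw∧v≡ψw
    ... | pw , v≡ψw with T-does⁻ (v ≟ʷ ψ w) v≡ψw
    ... | refl = let qψw , _ , φψw≡w = ψ-ok lw pw in
                 ∧-intro qψw (T-does⁺ (w ≟ʷ φ (ψ w)) (sym φψw≡w))
    from : T (q v ∧ does (w ≟ʷ φ v)) → T (p w ∧ does (v ≟ʷ ψ w))
    from qv∧w≡φv with ∧-elim qv∧w≡φv
    ... | qv , w≡φv with T-does⁻ (w ≟ʷ φ v) w≡φv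
    ... | refl = let pφv , _ , ψφv≡v = φ-ok lv qv in
                 ∧-intro pφv (T-does⁺ (v ≟ʷ ψ (φ v)) (sym ψφv≡v))

downs : List Step → ℕ
downs []      = 0
downs (U ∷ w) = downs w
downs (D ∷ w) = suc (downs w)

countWords-downs : ∀ n j → countWords n (λ v → does (downs v ≟ j)) ≡ n C j
countWords-downs zero    zero    = refl
countWords-downs zero    (suc j) = refl
countWords-downs (suc n) zero    =
  trans (∑-words-suc n _) (cong₂ _+_ (countWords-downs n 0) (∑-zero (words n) (λ _ → refl)))
countWords-downs (suc n) (suc j) = begin
  countWords (suc n) (λ v → does (downs v ≟ suc j))    ≡⟨ ∑-words-suc n _ ⟩
  countWords n (λ v → does (downs v ≟ suc j))
    + countWords n (λ v → does (downs v ≟ j))          ≡⟨ cong₂ _+_ (countWords-downs n (suc j)) (countWords-downs n j) ⟩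
  n C suc j + n C j                                    ≡⟨ +-comm (n C suc j) (n C j) ⟩
  n C j + n C suc j                                    ≡⟨ nCk+nC[k+1]≡[n+1]C[k+1] n j ⟩
  suc n C suc j                                        ∎

-- Run decomposition

U^_ D^_ : ℕ → List Step
U^ a = replicate a U
D^ b = replicate b D

runWord : List ℕ → List ℕ → List Step
runWord []       _        = []
runWord (_ ∷ _)  []       = []
runWord (a ∷ as) (b ∷ bs) = U^ a ++ (D^ b ++ runWord as bs)

replicate-++-∷ : ∀ {A : Set} n (x : A) w → replicate n x ++ (x ∷ w) ≡ x ∷ (replicate n x ++ w)
replicate-++-∷ zero    x w = refl
replicate-++-∷ (suc n) x w = cong (x ∷_) (replicate-++-∷ n x w)

Runs : List ℕ → List ℕ → Set
Runs as bs = length as ≡ length bs × All (1 ≤_) as × All (1 ≤_) bs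

descentAux : ℕ → List Step → List ℕ
descentAux zero    []      = []
descentAux (suc c) []      = suc c ∷ []
descentAux c       (D ∷ w) = descentAux (suc c) w
descentAux zero    (U ∷ w) = descentAux zero w
descentAux (suc c) (U ∷ w) = suc c ∷ descentAux zero w

descentComposition : List Step → List ℕ
descentComposition = descentAux 0

length-runWord : ∀ as bs → length as ≡ length bs → length (runWord as bs) ≡ sum as + sum bs
length-runWord []       []       _  = refl
length-runWord (a ∷ as) (b ∷ bs) eq = begin
  length (U^ a ++ (D^ b ++ runWord as bs))
    ≡⟨ length-++ (U^ a) ⟩
  length (U^ a) + length (D^ b ++ runWord as bs)
    ≡⟨ cong₂ _+_ (length-replicate a) (length-++ (D^ b)) ⟩
  a + (length (D^ b) + length (runWord as bs))
    ≡⟨ cong₂ (λ s t → a + (s + t)) (length-replicate b) (length-runWord as bs (suc-injective eq)) ⟩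
  a + (b + (sum as + sum bs))
    ≡⟨ shuffle a b (sum as) (sum bs) ⟩
  a + sum as + (b + sum bs) ∎
  where
  shuffle : ∀ a b c d → a + (b + (c + d)) ≡ a + c + (b + d)
  shuffle = solve-∀

private
  rise-U : ∀ c w → riseAux c (U ∷ w) ≡ riseAux (suc c) w
  rise-U zero    w = refl
  rise-U (suc c) w = refl

  rise-U^ : ∀ c a r → riseAux c (U^ a ++ r) ≡ riseAux (c + a) r
  rise-U^ c zero    r = cong (λ t → riseAux t r) (sym (+-identityʳ c))
  rise-U^ c (suc a) r = trans (rise-U c _) (trans (rise-U^ (suc c) a r) (cong (λ t → riseAux t r) (sym (+-suc c a))))

  rise-D^ : ∀ b r → riseAux 0 (D^ b ++ r) ≡ riseAux 0 r
  rise-D^ zero    r = refl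
  rise-D^ (suc b) r = rise-D^ b r

riseComposition-runWord : ∀ {as bs} → Runs as bs → riseComposition (runWord as bs) ≡ as
riseComposition-runWord {[]}        {[]}        _ = refl
riseComposition-runWord {suc a ∷ as} {suc b ∷ bs} (eq , _ ∷ as⁺ , _ ∷ bs⁺) =
  trans (rise-U^ 0 (suc a) _)
        (cong (suc a ∷_) (trans (rise-D^ b _) (riseComposition-runWord (suc-injective eq , as⁺ , bs⁺))))

private
  descent-D : ∀ c w → descentAux c (D ∷ w) ≡ descentAux (suc c) w
  descent-D zero    w = refl
  descent-D (suc c) w = refl

  descent-U^ : ∀ a r → descentAux 0 (U^ a ++ r) ≡ descentAux 0 r
  descent-U^ zero    r = refl
  descent-U^ (suc a) r = descent-U^ a r

  descent-D^ : ∀ c b r → descentAux c (D^ b ++ r) ≡ descentAux (c + b) r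
  descent-D^ c zero    r = cong (λ t → descentAux t r) (sym (+-identityʳ c))
  descent-D^ c (suc b) r = trans (descent-D c _) (trans (descent-D^ (suc c) b r) (cong (λ t → descentAux t r) (sym (+-suc c b))))

  descent-flush : ∀ c {as bs} → Runs as bs → descentAux (suc c) (runWord as bs) ≡ suc c ∷ descentAux 0 (runWord as bs)
  descent-flush c {[]}         {[]}    _ = refl
  descent-flush c {suc a ∷ as} {_ ∷ _} _ = refl
  descent-flush c {zero ∷ as}  {_ ∷ _} (_ , () ∷ _ , _)

descentComposition-runWord : ∀ {as bs} → Runs as bs → descentComposition (runWord as bs) ≡ bs
descentComposition-runWord {[]}     {[]}         _ = refl
descentComposition-runWord {a ∷ as} {suc b ∷ bs} (eq , _ ∷ as⁺ , _ ∷ bs⁺) = begin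
  descentAux 0 (U^ a ++ (D^ suc b ++ runWord as bs))   ≡⟨ descent-U^ a _ ⟩
  descentAux 0 (D^ suc b ++ runWord as bs)             ≡⟨ descent-D^ 0 (suc b) _ ⟩
  descentAux (suc b) (runWord as bs)                   ≡⟨ descent-flush b runs ⟩
  suc b ∷ descentComposition (runWord as bs)           ≡⟨ cong (suc b ∷_) (descentComposition-runWord runs) ⟩
  suc b ∷ bs                                           ∎
  where
  runs : Runs as bs
  runs = suc-injective eq , as⁺ , bs⁺

private
  dyck-U : ∀ h w → dyckFrom h (U ∷ w) ≡ dyckFrom (suc h) w
  dyck-U zero    w = refl
  dyck-U (suc h) w = refl

dyckFrom-U^ : ∀ h a r → dyckFrom h (U^ a ++ r) ≡ dyckFrom (h + a) r
dyckFrom-U^ h zero    r = cong (λ t → dyckFrom t r) (sym (+-identityʳ h))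
dyckFrom-U^ h (suc a) r = trans (dyck-U h _) (trans (dyckFrom-U^ (suc h) a r) (cong (λ t → dyckFrom t r) (sym (+-suc h a))))

dyckFrom-D^ : ∀ {h b} r → b ≤ h → dyckFrom h (D^ b ++ r) ≡ dyckFrom (h ∸ b) r
dyckFrom-D^ {_}     {zero}  r _         = refl
dyckFrom-D^ {suc h} {suc b} r (s≤s b≤h) = dyckFrom-D^ r b≤h

dyckFrom-D^-negative : ∀ {h b} r → h < b → dyckFrom h (D^ b ++ r) ≡ false
dyckFrom-D^-negative {zero}  {suc b} r _         = refl
dyckFrom-D^-negative {suc h} {suc b} r (s≤s h<b) = dyckFrom-D^-negative r h<b

-- A nonempty Dyck word starts with U and ends with D; nothing else is needed to split it into runs.
private
  endsInD : List Step → Bool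
  endsInD []          = false
  endsInD (U ∷ [])    = false
  endsInD (D ∷ [])    = true
  endsInD (_ ∷ t ∷ w) = endsInD (t ∷ w)

  dyckFrom⇒endsInD : ∀ h s w → T (dyckFrom h (s ∷ w)) → T (endsInD (s ∷ w))
  dyckFrom⇒endsInD h       U []      d = subst T (dyck-U h []) d
  dyckFrom⇒endsInD h       D []      d = _
  dyckFrom⇒endsInD h       U (t ∷ w) d = dyckFrom⇒endsInD (suc h) t w (subst T (dyck-U h _) d)
  dyckFrom⇒endsInD (suc h) D (t ∷ w) d = dyckFrom⇒endsInD h t w d

  RunDecomposition : List Step → Set
  RunDecomposition w = Σ[ as ∈ List ℕ ] Σ[ bs ∈ List ℕ ] Runs as bs × w ≡ runWord as bs

  mutual
    decompose-U : ∀ p w → T (endsInD (U ∷ w)) → RunDecomposition (U^ suc p ++ w)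
    decompose-U p (U ∷ w) e = subst RunDecomposition (cong (U ∷_) (sym (replicate-++-∷ p U w))) (decompose-U (suc p) w e)
    decompose-U p (D ∷ w) e = decompose-UD p 0 w e

    decompose-UD : ∀ p q w → T (endsInD (D ∷ w)) → RunDecomposition (U^ suc p ++ (D^ suc q ++ w))
    decompose-UD p q []      _ = suc p ∷ [] , suc q ∷ [] , (refl , s≤s z≤n ∷ [] , s≤s z≤n ∷ []) , refl
    decompose-UD p q (D ∷ w) e =
      subst RunDecomposition (cong (λ v → U^ suc p ++ (D ∷ v)) (sym (replicate-++-∷ q D w))) (decompose-UD p (suc q) w e)
    decompose-UD p q (U ∷ w) e with decompose-U 0 w e
    ... | as , bs , (eq , as⁺ , bs⁺) , w≡ =
      suc p ∷ as , suc q ∷ bs , (cong suc eq , s≤s z≤n ∷ as⁺ , s≤s z≤n ∷ bs⁺) ,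
      cong (λ v → U^ suc p ++ (D^ suc q ++ v)) w≡

dyck⇒runWord : ∀ w → T (isDyck w) → Σ[ as ∈ List ℕ ] Σ[ bs ∈ List ℕ ] Runs as bs × w ≡ runWord as bs
dyck⇒runWord []      _ = [] , [] , (refl , [] , []) , refl
dyck⇒runWord (U ∷ w) d = decompose-U 0 w (dyckFrom⇒endsInD 0 U w d)

-- Stars and bars

compositionWord : List ℕ → List Step
compositionWord []            = []
compositionWord (c ∷ [])      = U^ (c ∸ 1)
compositionWord (c ∷ c′ ∷ cs) = U^ (c ∸ 1) ++ (D ∷ compositionWord (c′ ∷ cs))

wordCompositionAux : ℕ → List Step → List ℕ
wordCompositionAux c []      = suc c ∷ []
wordCompositionAux c (U ∷ v) = wordCompositionAux (suc c) v
wordCompositionAux c (D ∷ v) = suc c ∷ wordCompositionAux 0 v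

wordComposition : List Step → List ℕ
wordComposition = wordCompositionAux 0

private
  aux-U^ : ∀ c a r → wordCompositionAux c (U^ a ++ r) ≡ wordCompositionAux (c + a) r
  aux-U^ c zero    r = cong (λ t → wordCompositionAux t r) (sym (+-identityʳ c))
  aux-U^ c (suc a) r = trans (aux-U^ (suc c) a r) (cong (λ t → wordCompositionAux t r) (sym (+-suc c a)))

  aux-nonempty : ∀ c v → ∃₂ λ d ds → wordCompositionAux c v ≡ d ∷ ds
  aux-nonempty c []      = _ , _ , refl
  aux-nonempty c (U ∷ v) = aux-nonempty (suc c) v
  aux-nonempty c (D ∷ v) = _ , _ , refl

  compositionWord-aux : ∀ c v → compositionWord (wordCompositionAux c v) ≡ U^ c ++ v
  compositionWord-aux c []      = sym (++-identityʳ (U^ c))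
  compositionWord-aux c (U ∷ v) = trans (compositionWord-aux (suc c) v) (sym (replicate-++-∷ c U v))
  compositionWord-aux c (D ∷ v) with aux-nonempty 0 v | compositionWord-aux 0 v
  ... | d , ds , eq | ih rewrite eq = cong (λ w → U^ c ++ (D ∷ w)) ih

wordComposition-compositionWord : ∀ {c} → All (1 ≤_) c → 1 ≤ length c → wordComposition (compositionWord c) ≡ c
wordComposition-compositionWord {suc c ∷ []}      (_ ∷ [])  _ =
  trans (cong wordComposition (sym (++-identityʳ (U^ c)))) (aux-U^ 0 c [])
wordComposition-compositionWord {suc c ∷ c′ ∷ cs} (_ ∷ c⁺) _ =
  trans (aux-U^ 0 c _) (cong (suc c ∷_) (wordComposition-compositionWord c⁺ (s≤s z≤n)))

compositionWord-wordComposition : ∀ v → compositionWord (wordComposition v) ≡ v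
compositionWord-wordComposition = compositionWord-aux 0

length-wordCompositionAux : ∀ c v → length (wordCompositionAux c v) ≡ suc (downs v)
length-wordCompositionAux c []      = refl
length-wordCompositionAux c (U ∷ v) = length-wordCompositionAux (suc c) v
length-wordCompositionAux c (D ∷ v) = cong suc (length-wordCompositionAux 0 v)

sum-wordCompositionAux : ∀ c v → sum (wordCompositionAux c v) ≡ suc c + length v
sum-wordCompositionAux c []      = refl
sum-wordCompositionAux c (U ∷ v) = trans (sum-wordCompositionAux (suc c) v) (cong suc (sym (+-suc c (length v))))
sum-wordCompositionAux c (D ∷ v) = cong (suc c +_) (sum-wordCompositionAux 0 v)

wordCompositionAux-positive : ∀ c v → All (1 ≤_) (wordCompositionAux c v)
wordCompositionAux-positive c []      = s≤s z≤n ∷ []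
wordCompositionAux-positive c (U ∷ v) = wordCompositionAux-positive (suc c) v
wordCompositionAux-positive c (D ∷ v) = s≤s z≤n ∷ wordCompositionAux-positive 0 v

module _ {c : List ℕ} (c⁺ : All (1 ≤_) c) (c≢[] : 1 ≤ length c) where

  suc-length-compositionWord : suc (length (compositionWord c)) ≡ sum c
  suc-length-compositionWord =
    trans (sym (sum-wordCompositionAux 0 (compositionWord c))) (cong sum (wordComposition-compositionWord c⁺ c≢[]))

  suc-downs-compositionWord : suc (downs (compositionWord c)) ≡ length c
  suc-downs-compositionWord =
    trans (sym (length-wordCompositionAux 0 (compositionWord c))) (cong length (wordComposition-compositionWord c⁺ c≢[]))

module _ {n k : ℕ} (k≥1 : 1 ≤ k) where

  private
    suc[k∸1]≡k : suc (k ∸ 1) ≡ k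
    suc[k∸1]≡k = trans (+-comm 1 (k ∸ 1)) (m∸n+n≡m k≥1)

    nonempty : ∀ (c : List ℕ) → length c ≡ k → 1 ≤ length c
    nonempty _ |c| = subst (1 ≤_) (sym |c|) k≥1

  wordComposition-isComposition : ∀ v → length v ≡ n → downs v ≡ k ∸ 1 →
                                  IsComposition (suc n) k (wordComposition v)
  wordComposition-isComposition v |v| downs≡ =
    wordCompositionAux-positive 0 v ,
    trans (sum-wordCompositionAux 0 v) (cong suc |v|) ,
    trans (length-wordCompositionAux 0 v) (trans (cong suc downs≡) suc[k∸1]≡k)

  length-compositionWord : ∀ {c} → IsComposition (suc n) k c → length (compositionWord c) ≡ n
  length-compositionWord {c} (c⁺ , Σc , |c|) = suc-injective (trans (suc-length-compositionWord c⁺ (nonempty c |c|)) Σc)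

  downs-compositionWord : ∀ {c} → IsComposition (suc n) k c → downs (compositionWord c) ≡ k ∸ 1
  downs-compositionWord {c} (c⁺ , _ , |c|) =
    suc-injective (trans (suc-downs-compositionWord c⁺ (nonempty c |c|)) (trans |c| (sym suc[k∸1]≡k)))

  decode-compositionWord : ∀ {c} → IsComposition (suc n) k c → wordComposition (compositionWord c) ≡ c
  decode-compositionWord {c} (c⁺ , _ , |c|) = wordComposition-compositionWord c⁺ (nonempty c |c|)

-- Ballot condition

-- h + e₁ + ⋯ + eⱼ ≥ 0 for 1 ≤ j < length es: the full sum is deliberately not tested.
nonnegPrefixes : ℤ → List ℤ → Bool
nonnegPrefixes h []            = true
nonnegPrefixes h (e ∷ [])      = true
nonnegPrefixes h (e ∷ e′ ∷ es) = does (0ℤ ℤ.≤? h ℤ.+ e) ∧ nonnegPrefixes (h ℤ.+ e) (e′ ∷ es)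

differences : List ℕ → List ℕ → List ℤ
differences = zipWith _⊖_

decrementLast incrementLast : List ℕ → List ℕ
decrementLast []           = []
decrementLast (c ∷ [])     = c ∸ 1 ∷ []
decrementLast (c ∷ c′ ∷ cs) = c ∷ decrementLast (c′ ∷ cs)
incrementLast []           = []
incrementLast (c ∷ [])     = suc c ∷ []
incrementLast (c ∷ c′ ∷ cs) = c ∷ incrementLast (c′ ∷ cs)

private
  +h+[a⊖c]≡+[h+a∸c] : ∀ h a c → c ≤ h + a → pos h ℤ.+ (a ⊖ c) ≡ pos (h + a ∸ c)
  +h+[a⊖c]≡+[h+a∸c] h a c c≤h+a = trans (ℤ.distribʳ-⊖-+-pos h a c) (ℤ.⊖-≥ c≤h+a)

  0≤m⊖n⇒n≤m : ∀ m n → 0ℤ ℤ.≤ m ⊖ n → n ≤ m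
  0≤m⊖n⇒n≤m m       zero    _  = z≤n
  0≤m⊖n⇒n≤m (suc m) (suc n) le = s≤s (0≤m⊖n⇒n≤m m n (subst (0ℤ ℤ.≤_) (ℤ.[1+m]⊖[1+n]≡m⊖n m n) le))

  0≤+h+[a⊖c]⇒c≤h+a : ∀ h a c → 0ℤ ℤ.≤ pos h ℤ.+ (a ⊖ c) → c ≤ h + a
  0≤+h+[a⊖c]⇒c≤h+a h a c le = 0≤m⊖n⇒n≤m (h + a) c (subst (0ℤ ℤ.≤_) (ℤ.distribʳ-⊖-+-pos h a c) le)

  nonnegPrefixes-step : ∀ h a c e es →
    T (nonnegPrefixes (pos h) ((a ⊖ c) ∷ e ∷ es)) → c ≤ h + a × T (nonnegPrefixes (pos (h + a ∸ c)) (e ∷ es))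
  nonnegPrefixes-step h a c e es t with ∧-elim t
  ... | now , later = c≤h+a , subst (λ i → T (nonnegPrefixes i (e ∷ es))) (+h+[a⊖c]≡+[h+a∸c] h a c c≤h+a) later
    where
    c≤h+a : c ≤ h + a
    c≤h+a = 0≤+h+[a⊖c]⇒c≤h+a h a c (T-does⁻ (0ℤ ℤ.≤? _) now)

  nonnegPrefixes-step⁻ : ∀ h a c e es → c ≤ h + a →
    T (nonnegPrefixes (pos (h + a ∸ c)) (e ∷ es)) → T (nonnegPrefixes (pos h) ((a ⊖ c) ∷ e ∷ es))
  nonnegPrefixes-step⁻ h a c e es c≤h+a later rewrite +h+[a⊖c]≡+[h+a∸c] h a c c≤h+a =
    later

  dyckFrom-peak : ∀ h a c r → T (dyckFrom h (U^ a ++ (D^ c ++ r))) → c ≤ h + a × T (dyckFrom (h + a ∸ c) r)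
  dyckFrom-peak h a c r d rewrite dyckFrom-U^ h a (D^ c ++ r) with c ≤? h + a
  ... | yes c≤h+a = c≤h+a , subst T (dyckFrom-D^ r c≤h+a) d
  ... | no  c≰h+a = ⊥-elim (subst T (dyckFrom-D^-negative r (≰⇒> c≰h+a)) d)

  dyckFrom-peak⁻ : ∀ h a c r → c ≤ h + a → T (dyckFrom (h + a ∸ c) r) → T (dyckFrom h (U^ a ++ (D^ c ++ r)))
  dyckFrom-peak⁻ h a c r c≤h+a d rewrite dyckFrom-U^ h a (D^ c ++ r) | dyckFrom-D^ r c≤h+a = d

dyck⇒nonnegPrefixes : ∀ h {as cs} → length as ≡ length cs → T (dyckFrom h (runWord as cs)) →
                      T (nonnegPrefixes (pos h) (differences as cs))
dyck⇒nonnegPrefixes h {[]}           {[]}           _  _ = _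
dyck⇒nonnegPrefixes h {_ ∷ []}       {_ ∷ []}       _  _ = _
dyck⇒nonnegPrefixes h {a ∷ a′ ∷ as} {c ∷ c′ ∷ cs} eq d =
  let c≤h+a , d′ = dyckFrom-peak h a c _ d in
  nonnegPrefixes-step⁻ h a c (a′ ⊖ c′) (differences as cs) c≤h+a
    (dyck⇒nonnegPrefixes (h + a ∸ c) {a′ ∷ as} {c′ ∷ cs} (suc-injective eq) d′)

nonnegPrefixes⇒dyck : ∀ h {as cs} → Runs as cs → 1 ≤ length as →
  T (nonnegPrefixes (pos h) (differences as cs)) → h + sum as + 1 ≡ sum cs →
  All (1 ≤_) (decrementLast cs) × T (dyckFrom h (runWord as (decrementLast cs)))
nonnegPrefixes⇒dyck h {a ∷ []} {c ∷ []} (_ , a⁺ ∷ [] , _) _ _ total =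
  subst (1 ≤_) (sym c∸1≡h+a) (≤-trans a⁺ (m≤n+m a h)) ∷ [] ,
  subst (λ b → T (dyckFrom h (U^ a ++ (D^ b ++ [])))) (sym c∸1≡h+a)
        (dyckFrom-peak⁻ h a (h + a) [] ≤-refl (subst (λ t → T (dyckFrom t [])) (sym (n∸n≡0 (h + a))) _))
  where
  c∸1≡h+a : c ∸ 1 ≡ h + a
  c∸1≡h+a = begin
    c ∸ 1                 ≡⟨ cong (_∸ 1) (trans (sym (+-identityʳ c)) (sym total)) ⟩
    h + (a + 0) + 1 ∸ 1   ≡⟨ m+n∸n≡m _ 1 ⟩
    h + (a + 0)           ≡⟨ cong (h +_) (+-identityʳ a) ⟩
    h + a                 ∎
nonnegPrefixes⇒dyck h {a ∷ a′ ∷ as} {c ∷ c′ ∷ cs} (eq , _ ∷ as⁺ , c⁺ ∷ cs⁺) _ ballot total =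
  let c≤h+a , ballot′ = nonnegPrefixes-step h a c (a′ ⊖ c′) (differences as cs) ballot
      cs′⁺ , d = nonnegPrefixes⇒dyck (h + a ∸ c) {a′ ∷ as} {c′ ∷ cs} (suc-injective eq , as⁺ , cs⁺) (s≤s z≤n)
                                     ballot′ (total′ c≤h+a)
  in c⁺ ∷ cs′⁺ , dyckFrom-peak⁻ h a c _ c≤h+a d
  where
  total′ : c ≤ h + a → h + a ∸ c + sum (a′ ∷ as) + 1 ≡ sum (c′ ∷ cs)
  total′ c≤h+a = +-cancelˡ-≡ c _ _ (begin
    c + (h + a ∸ c + sum (a′ ∷ as) + 1)   ≡⟨ reassoc c (h + a ∸ c) (sum (a′ ∷ as)) ⟩
    c + (h + a ∸ c) + sum (a′ ∷ as) + 1   ≡⟨ cong (λ t → t + sum (a′ ∷ as) + 1) (m+[n∸m]≡n c≤h+a) ⟩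
    h + a + sum (a′ ∷ as) + 1             ≡⟨ cong (_+ 1) (+-assoc h a _) ⟩
    h + sum (a ∷ a′ ∷ as) + 1             ≡⟨ total ⟩
    c + sum (c′ ∷ cs)                     ∎)
    where
    reassoc : ∀ x y z → x + (y + z + 1) ≡ x + y + z + 1
    reassoc = solve-∀

nonnegPrefixes-incrementLast : ∀ h {as cs} → length as ≡ length cs →
  nonnegPrefixes h (differences as (incrementLast cs)) ≡ nonnegPrefixes h (differences as cs)
nonnegPrefixes-incrementLast h {[]}              {[]}              _  = refl
nonnegPrefixes-incrementLast h {_ ∷ []}          {_ ∷ []}          _  = refl
nonnegPrefixes-incrementLast h {_ ∷ _ ∷ []}      {_ ∷ _ ∷ []}      _  = refl
nonnegPrefixes-incrementLast h {a ∷ a′ ∷ a″ ∷ as} {c ∷ c′ ∷ c″ ∷ cs} eq =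
  cong (does (0ℤ ℤ.≤? h ℤ.+ (a ⊖ c)) ∧_)
       (nonnegPrefixes-incrementLast (h ℤ.+ (a ⊖ c)) {a′ ∷ a″ ∷ as} {c′ ∷ c″ ∷ cs} (suc-injective eq))

length-decrementLast : ∀ cs → length (decrementLast cs) ≡ length cs
length-decrementLast []           = refl
length-decrementLast (_ ∷ [])     = refl
length-decrementLast (_ ∷ c ∷ cs) = cong suc (length-decrementLast (c ∷ cs))

length-incrementLast : ∀ cs → length (incrementLast cs) ≡ length cs
length-incrementLast []           = refl
length-incrementLast (_ ∷ [])     = refl
length-incrementLast (_ ∷ c ∷ cs) = cong suc (length-incrementLast (c ∷ cs))

sum-incrementLast : ∀ cs → 1 ≤ length cs → sum (incrementLast cs) ≡ suc (sum cs)
sum-incrementLast (c ∷ [])      _ = refl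
sum-incrementLast (c ∷ c′ ∷ cs) _ = trans (cong (c +_) (sum-incrementLast (c′ ∷ cs) (s≤s z≤n))) (+-suc c _)

suc-sum-decrementLast : ∀ {cs} → All (1 ≤_) cs → 1 ≤ length cs → suc (sum (decrementLast cs)) ≡ sum cs
suc-sum-decrementLast {suc c ∷ []}  _         _ = refl
suc-sum-decrementLast {c ∷ c′ ∷ cs} (_ ∷ cs⁺) _ =
  trans (sym (+-suc c _)) (cong (c +_) (suc-sum-decrementLast cs⁺ (s≤s z≤n)))

decrementLast-incrementLast : ∀ cs → decrementLast (incrementLast cs) ≡ cs
decrementLast-incrementLast []           = refl
decrementLast-incrementLast (_ ∷ [])     = refl
decrementLast-incrementLast (_ ∷ _ ∷ [])       = refl
decrementLast-incrementLast (c ∷ c′ ∷ c″ ∷ cs) = cong (c ∷_) (decrementLast-incrementLast (c′ ∷ c″ ∷ cs))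

incrementLast-decrementLast : ∀ {cs} → All (1 ≤_) cs → incrementLast (decrementLast cs) ≡ cs
incrementLast-decrementLast {[]}          _         = refl
incrementLast-decrementLast {suc _ ∷ []}      _              = refl
incrementLast-decrementLast {zero ∷ []}       (() ∷ _)
incrementLast-decrementLast {_ ∷ suc _ ∷ []}  _              = refl
incrementLast-decrementLast {_ ∷ zero ∷ []}   (_ ∷ () ∷ _)
incrementLast-decrementLast {c ∷ c′ ∷ c″ ∷ cs} (_ ∷ cs⁺) = cong (c ∷_) (incrementLast-decrementLast cs⁺)

incrementLast-positive : ∀ {cs} → All (1 ≤_) cs → All (1 ≤_) (incrementLast cs)
incrementLast-positive {[]}          []          = []
incrementLast-positive {_ ∷ []}      (_ ∷ [])    = s≤s z≤n ∷ []
incrementLast-positive {_ ∷ _ ∷ _}   (c⁺ ∷ cs⁺) = c⁺ ∷ incrementLast-positive cs⁺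

module _ {A : Set} where

  cyclicShift : ℕ → List A → List A
  cyclicShift i xs = drop i xs ++ take i xs

  length-cyclicShift : ∀ i (xs : List A) → length (cyclicShift i xs) ≡ length xs
  length-cyclicShift i xs = begin
    length (drop i xs ++ take i xs)        ≡⟨ length-++ (drop i xs) ⟩
    length (drop i xs) + length (take i xs) ≡⟨ +-comm (length (drop i xs)) _ ⟩
    length (take i xs) + length (drop i xs) ≡⟨ length-++ (take i xs) ⟨
    length (take i xs ++ drop i xs)        ≡⟨ cong length (take++drop≡id i xs) ⟩
    length xs                              ∎

  cyclicShift-All : ∀ {P : A → Set} i {xs} → All P xs → All P (cyclicShift i xs)
  cyclicShift-All i xs⁺ = ++⁺ (drop⁺ i xs⁺) (take⁺ i xs⁺)

  private
    drop-∷ : ∀ i (xs : List A) → i < length xs → ∃₂ λ x rest →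
             drop i xs ≡ x ∷ rest × drop (suc i) xs ≡ rest × take (suc i) xs ≡ take i xs ++ [ x ]
    drop-∷ zero    (x ∷ xs) _         = x , xs , refl , refl , refl
    drop-∷ (suc i) (y ∷ xs) (s≤s i<n) with drop-∷ i xs i<n
    ... | x , rest , d≡ , d′≡ , t≡ = x , rest , d≡ , d′≡ , cong (y ∷_) t≡

  cyclicShift-suc : ∀ i (xs : List A) → i < length xs → cyclicShift (suc i) xs ≡ cyclicShift 1 (cyclicShift i xs)
  cyclicShift-suc i xs i<n with drop-∷ i xs i<n
  ... | x , rest , d≡ , d′≡ , t≡ = begin
    drop (suc i) xs ++ take (suc i) xs  ≡⟨ cong₂ _++_ d′≡ t≡ ⟩
    rest ++ (take i xs ++ [ x ])        ≡⟨ ++-assoc rest (take i xs) _ ⟨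
    (rest ++ take i xs) ++ [ x ]        ≡⟨ cong (λ ys → cyclicShift 1 (ys ++ take i xs)) d≡ ⟨
    cyclicShift 1 (cyclicShift i xs)    ∎

  shift₁^ : ℕ → List A → List A
  shift₁^ zero    xs = xs
  shift₁^ (suc t) xs = cyclicShift 1 (shift₁^ t xs)

  cyclicShift≡shift₁^ : ∀ i (xs : List A) → i ≤ length xs → cyclicShift i xs ≡ shift₁^ i xs
  cyclicShift≡shift₁^ zero    xs _   = ++-identityʳ xs
  cyclicShift≡shift₁^ (suc i) xs i<n = trans (cyclicShift-suc i xs i<n) (cong (cyclicShift 1) (cyclicShift≡shift₁^ i xs (<⇒≤ i<n)))

  shift₁^-+ : ∀ a b (xs : List A) → shift₁^ (a + b) xs ≡ shift₁^ a (shift₁^ b xs)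
  shift₁^-+ zero    b xs = refl
  shift₁^-+ (suc a) b xs = cong (cyclicShift 1) (shift₁^-+ a b xs)

  shift₁^-length : ∀ (xs : List A) → shift₁^ (length xs) xs ≡ xs
  shift₁^-length xs = begin
    shift₁^ (length xs) xs        ≡⟨ cyclicShift≡shift₁^ (length xs) xs ≤-refl ⟨
    drop (length xs) xs ++ take (length xs) xs ≡⟨ cong₂ _++_ (drop-all _ xs ≤-refl) (take-all _ xs ≤-refl) ⟩
    xs                            ∎

  shift₁^-periodic : ∀ t (xs : List A) → shift₁^ (length xs + t) xs ≡ shift₁^ t xs
  shift₁^-periodic t xs = begin
    shift₁^ (length xs + t) xs       ≡⟨ cong (λ s → shift₁^ s xs) (+-comm (length xs) t) ⟩
    shift₁^ (t + length xs) xs       ≡⟨ shift₁^-+ t (length xs) xs ⟩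
    shift₁^ t (shift₁^ (length xs) xs) ≡⟨ cong (shift₁^ t) (shift₁^-length xs) ⟩
    shift₁^ t xs                     ∎

  cyclicShift-inverse : ∀ {i j} (xs : List A) → i + j ≡ length xs → cyclicShift i (cyclicShift j xs) ≡ xs
  cyclicShift-inverse {i} {j} xs i+j≡n = begin
    cyclicShift i (cyclicShift j xs)
      ≡⟨ cyclicShift≡shift₁^ i _ (subst (i ≤_) (sym (length-cyclicShift j xs)) (m+n≤o⇒m≤o i (≤-reflexive i+j≡n))) ⟩
    shift₁^ i (cyclicShift j xs)
      ≡⟨ cong (shift₁^ i) (cyclicShift≡shift₁^ j xs (m+n≤o⇒n≤o i (≤-reflexive i+j≡n))) ⟩
    shift₁^ i (shift₁^ j xs)
      ≡⟨ shift₁^-+ i j xs ⟨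
    shift₁^ (i + j) xs
      ≡⟨ cong (λ s → shift₁^ s xs) i+j≡n ⟩
    shift₁^ (length xs) xs
      ≡⟨ shift₁^-length xs ⟩
    xs ∎

sum-rotate : ∀ i xs → sum (rotate i xs) ≡ sum xs
sum-rotate i xs = begin
  sum (drop i xs ++ take i xs)     ≡⟨ sum-++ (drop i xs) (take i xs) ⟩
  sum (drop i xs) + sum (take i xs) ≡⟨ +-comm (sum (drop i xs)) _ ⟩
  sum (take i xs) + sum (drop i xs) ≡⟨ sum-++ (take i xs) (drop i xs) ⟨
  sum (take i xs ++ drop i xs)     ≡⟨ cong sum (take++drop≡id i xs) ⟩
  sum xs                           ∎

module _ {A B C : Set} (f : A → B → C) where
  private
    zipWith-drop : ∀ i (xs : List A) (ys : List B) → zipWith f (drop i xs) (drop i ys) ≡ drop i (zipWith f xs ys)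
    zipWith-drop zero    xs       ys       = refl
    zipWith-drop (suc i) []       ys       = refl
    zipWith-drop (suc i) (x ∷ xs) []       = zipWith-zeroʳ f (drop i xs)
    zipWith-drop (suc i) (x ∷ xs) (y ∷ ys) = zipWith-drop i xs ys

    zipWith-take : ∀ i (xs : List A) (ys : List B) → zipWith f (take i xs) (take i ys) ≡ take i (zipWith f xs ys)
    zipWith-take zero    xs       ys       = refl
    zipWith-take (suc i) []       ys       = refl
    zipWith-take (suc i) (x ∷ xs) []       = refl
    zipWith-take (suc i) (x ∷ xs) (y ∷ ys) = cong (f x y ∷_) (zipWith-take i xs ys)

    zipWith-++ : ∀ (xs xs′ : List A) (ys ys′ : List B) → length xs ≡ length ys →
                 zipWith f (xs ++ xs′) (ys ++ ys′) ≡ zipWith f xs ys ++ zipWith f xs′ ys′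
    zipWith-++ []       xs′ []       ys′ _  = refl
    zipWith-++ (x ∷ xs) xs′ (y ∷ ys) ys′ eq = cong (f x y ∷_) (zipWith-++ xs xs′ ys ys′ (suc-injective eq))

  zipWith-cyclicShift : ∀ i (xs : List A) (ys : List B) → length xs ≡ length ys →
                        zipWith f (cyclicShift i xs) (cyclicShift i ys) ≡ cyclicShift i (zipWith f xs ys)
  zipWith-cyclicShift i xs ys eq = begin
    zipWith f (drop i xs ++ take i xs) (drop i ys ++ take i ys)
      ≡⟨ zipWith-++ (drop i xs) (take i xs) (drop i ys) (take i ys) drop-lengths ⟩
    zipWith f (drop i xs) (drop i ys) ++ zipWith f (take i xs) (take i ys)
      ≡⟨ cong₂ _++_ (zipWith-drop i xs ys) (zipWith-take i xs ys) ⟩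
    cyclicShift i (zipWith f xs ys) ∎
    where
    drop-lengths : length (drop i xs) ≡ length (drop i ys)
    drop-lengths = trans (length-drop i xs) (trans (cong (_∸ i) eq) (sym (length-drop i ys)))

-- The cycle lemma

module WalkWithDrift (S : ℕ → ℤ) (k : ℕ) (drift : ∀ t → t ≤ k → S (k + t) ≡ pred (S t)) where

  MinimalAhead : ℕ → Set
  MinimalAhead i = ∀ m → m < k → S i ℤ.≤ S (i + m)

  private
    FirstMinimum : ℕ → Set
    FirstMinimum K = Σ[ i₀ ∈ ℕ ] i₀ < K × (∀ u → u < K → S i₀ ℤ.≤ S u) × (∀ u → u < i₀ → S i₀ ℤ.< S u)

    firstMinimum : ∀ K → 1 ≤ K → FirstMinimum K
    firstMinimum (suc zero) _ = 0 , s≤s z≤n , (λ { zero _ → ℤ.≤-refl ; (suc u) (s≤s ()) }) , (λ u ())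
    firstMinimum (suc (suc K)) _ with firstMinimum (suc K) (s≤s z≤n)
    ... | i₀ , i₀<K , min , first with S (suc K) ℤ.<? S i₀
    ...   | yes new< = suc K , ≤-refl , min′ , (λ u u<1+K → ℤ.<-≤-trans new< (min u u<1+K))
      where
      min′ : ∀ u → u < suc (suc K) → S (suc K) ℤ.≤ S u
      min′ u u< with m<1+n⇒m<n∨m≡n u<
      ... | inj₁ u<1+K = ℤ.<⇒≤ (ℤ.<-≤-trans new< (min u u<1+K))
      ... | inj₂ refl  = ℤ.≤-refl
    ...   | no  new≮ = i₀ , m≤n⇒m≤1+n i₀<K , min′ , first
      where
      min′ : ∀ u → u < suc (suc K) → S i₀ ℤ.≤ S u
      min′ u u< with m<1+n⇒m<n∨m≡n u<
      ... | inj₁ u<1+K = min u u<1+K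
      ... | inj₂ refl  = ℤ.≮⇒≥ new≮

  -- Take the first minimum i₀ of S on [0, k); a window reaching past k ends at k + u with u < i₀,
  -- and S (k + u) = S u − 1 ≥ S i₀ because S u > S i₀.
  minimalAhead-exists : 1 ≤ k → ∃[ i ] i < k × MinimalAhead i
  minimalAhead-exists k≥1 with firstMinimum k k≥1
  ... | i₀ , i₀<k , min , first = i₀ , i₀<k , ahead
    where
    ahead : MinimalAhead i₀
    ahead m m<k with i₀ + m <? k
    ... | yes i₀+m<k = min (i₀ + m) i₀+m<k
    ... | no  i₀+m≮k = ℤ.≤-trans (ℤ.i<j⇒i≤pred[j] (first u u<i₀))
                                 (ℤ.≤-reflexive (sym (trans (cong S i₀+m≡k+u) (drift u (<⇒≤ (<-≤-trans u<i₀ (<⇒≤ i₀<k)))))))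
      where
      u : ℕ
      u = i₀ + m ∸ k
      i₀+m≡k+u : i₀ + m ≡ k + u
      i₀+m≡k+u = sym (m+[n∸m]≡n (≮⇒≥ i₀+m≮k))
      u<i₀ : u < i₀
      u<i₀ = +-cancelˡ-< k u i₀ (subst (_< k + i₀) i₀+m≡k+u (subst (i₀ + m <_) (+-comm i₀ k) (+-monoʳ-< i₀ m<k)))

  private
    -- S i ≤ S j ≤ S (k + i) = S i − 1.
    minimalAhead-< : ∀ {i j} → i < j → j < k → MinimalAhead i → MinimalAhead j → ⊥
    minimalAhead-< {i} {j} i<j j<k ahead-i ahead-j =
      ℤ.<-irrefl refl (ℤ.i≤pred[j]⇒i<j (ℤ.≤-trans Si≤Sj (subst (S j ℤ.≤_) S[j+m]≡predSi (ahead-j m m<k))))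
      where
      Si≤Sj : S i ℤ.≤ S j
      Si≤Sj = subst (λ t → S i ℤ.≤ S t) (m+[n∸m]≡n (<⇒≤ i<j)) (ahead-i (j ∸ i) (≤-<-trans (m∸n≤m j i) j<k))
      m : ℕ
      m = k + i ∸ j
      j+m≡k+i : j + m ≡ k + i
      j+m≡k+i = m+[n∸m]≡n (≤-trans (<⇒≤ j<k) (m≤m+n k i))
      m<k : m < k
      m<k = +-cancelˡ-< j m k (subst (_< j + k) (sym j+m≡k+i) (subst (k + i <_) (+-comm k j) (+-monoʳ-< k i<j)))
      S[j+m]≡predSi : S (j + m) ≡ pred (S i)
      S[j+m]≡predSi = trans (cong S j+m≡k+i) (drift i (<⇒≤ (<-trans i<j j<k)))

  minimalAhead-unique : ∀ {i j} → i < k → j < k → MinimalAhead i → MinimalAhead j → i ≡ j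
  minimalAhead-unique {i} {j} i<k j<k ahead-i ahead-j with <-cmp i j
  ... | tri< i<j _ _ = ⊥-elim (minimalAhead-< i<j j<k ahead-i ahead-j)
  ... | tri≈ _ i≡j _ = i≡j
  ... | tri> _ _ j<i = ⊥-elim (minimalAhead-< j<i i<k ahead-j ahead-i)

sumℤ : List ℤ → ℤ
sumℤ []       = 0ℤ
sumℤ (e ∷ es) = e ℤ.+ sumℤ es

private
  sumℤ-++ : ∀ es fs → sumℤ (es ++ fs) ≡ sumℤ es ℤ.+ sumℤ fs
  sumℤ-++ []       fs = sym (ℤ.+-identityˡ _)
  sumℤ-++ (e ∷ es) fs = trans (cong (λ t → e ℤ.+ t) (sumℤ-++ es fs)) (sym (ℤ.+-assoc e _ _))

  sumℤ-take-+ : ∀ i m es → sumℤ (take (i + m) es) ≡ sumℤ (take i es) ℤ.+ sumℤ (take m (drop i es))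
  sumℤ-take-+ zero    m es       = sym (ℤ.+-identityˡ _)
  sumℤ-take-+ (suc i) m []       rewrite take-[] {A = ℤ} m = refl
  sumℤ-take-+ (suc i) m (e ∷ es) = trans (cong (λ t → e ℤ.+ t) (sumℤ-take-+ i m es)) (sym (ℤ.+-assoc e _ _))

  module _ {A : Set} where
    drop-++ : ∀ i (xs ys : List A) → i ≤ length xs → drop i (xs ++ ys) ≡ drop i xs ++ ys
    drop-++ zero    xs       ys _         = refl
    drop-++ (suc i) (x ∷ xs) ys (s≤s i≤n) = drop-++ i xs ys i≤n

    take-++ : ∀ i (xs ys : List A) → length xs ≤ i → take i (xs ++ ys) ≡ xs ++ take (i ∸ length xs) ys
    take-++ i       []       ys _         = refl
    take-++ (suc i) (x ∷ xs) ys (s≤s n≤i) = cong (x ∷_) (take-++ i xs ys n≤i)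

    take-++ˡ : ∀ i (xs ys : List A) → i ≤ length xs → take i (xs ++ ys) ≡ take i xs
    take-++ˡ zero    xs       ys _         = refl
    take-++ˡ (suc i) (x ∷ xs) ys (s≤s i≤n) = cong (x ∷_) (take-++ˡ i xs ys i≤n)

    cyclicShift-window : ∀ i (xs : List A) → i ≤ length xs → cyclicShift i xs ≡ take (length xs) (drop i (xs ++ xs))
    cyclicShift-window i xs i≤n = sym (begin
      take (length xs) (drop i (xs ++ xs))
        ≡⟨ cong (take (length xs)) (drop-++ i xs xs i≤n) ⟩
      take (length xs) (drop i xs ++ xs)
        ≡⟨ take-++ (length xs) (drop i xs) xs (subst (_≤ length xs) (sym |drop|≡) (m∸n≤m _ i)) ⟩
      drop i xs ++ take (length xs ∸ length (drop i xs)) xs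
        ≡⟨ cong (λ t → drop i xs ++ take (length xs ∸ t) xs) |drop|≡ ⟩
      drop i xs ++ take (length xs ∸ (length xs ∸ i)) xs
        ≡⟨ cong (λ t → drop i xs ++ take t xs) (m∸[m∸n]≡n i≤n) ⟩
      cyclicShift i xs ∎)
      where
      |drop|≡ : length (drop i xs) ≡ length xs ∸ i
      |drop|≡ = length-drop i xs

  nonnegPrefixes⇒ : ∀ h es → 0ℤ ℤ.≤ h → T (nonnegPrefixes h es) → ∀ m → m < length es → 0ℤ ℤ.≤ h ℤ.+ sumℤ (take m es)
  nonnegPrefixes⇒ h (e ∷ es)      0≤h _ zero    _   = subst (0ℤ ℤ.≤_) (sym (ℤ.+-identityʳ h)) 0≤h
  nonnegPrefixes⇒ h (e ∷ e′ ∷ es) _   t (suc m) (s≤s m<n) with ∧-elim t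
  ... | now , later = subst (0ℤ ℤ.≤_) (ℤ.+-assoc h e _)
                        (nonnegPrefixes⇒ (h ℤ.+ e) (e′ ∷ es) (T-does⁻ (0ℤ ℤ.≤? _) now) later m m<n)

  ⇒nonnegPrefixes : ∀ h es → (∀ m → m < length es → 0ℤ ℤ.≤ h ℤ.+ sumℤ (take m es)) → T (nonnegPrefixes h es)
  ⇒nonnegPrefixes h []            _        = _
  ⇒nonnegPrefixes h (e ∷ [])      _        = _
  ⇒nonnegPrefixes h (e ∷ e′ ∷ es) prefixes =
    ∧-intro (T-does⁺ (0ℤ ℤ.≤? h ℤ.+ e)
              (subst (0ℤ ℤ.≤_) (cong (λ t → h ℤ.+ t) (ℤ.+-identityʳ e)) (prefixes 1 (s≤s (s≤s z≤n)))))
            (⇒nonnegPrefixes (h ℤ.+ e) (e′ ∷ es)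
              (λ m m<n → subst (0ℤ ℤ.≤_) (sym (ℤ.+-assoc h e _)) (prefixes (suc m) (s≤s m<n))))

  ≤-cancelˡ : ∀ a x → a ℤ.≤ a ℤ.+ x → 0ℤ ℤ.≤ x
  ≤-cancelˡ a x a≤a+x = subst₂ ℤ._≤_ (ℤ.+-inverseˡ a) (begin
      ℤ.- a ℤ.+ (a ℤ.+ x)   ≡⟨ ℤ.+-assoc (ℤ.- a) a x ⟨
      ℤ.- a ℤ.+ a ℤ.+ x     ≡⟨ cong (ℤ._+ x) (ℤ.+-inverseˡ a) ⟩
      0ℤ ℤ.+ x              ≡⟨ ℤ.+-identityˡ x ⟩
      x                     ∎)
    (ℤ.+-monoʳ-≤ (ℤ.- a) a≤a+x)

  ≤-extendˡ : ∀ a x → 0ℤ ℤ.≤ x → a ℤ.≤ a ℤ.+ x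
  ≤-extendˡ a x 0≤x = subst (ℤ._≤ a ℤ.+ x) (ℤ.+-identityʳ a) (ℤ.+-monoʳ-≤ a 0≤x)

module _ (es : List ℤ) (Σes≡-1 : sumℤ es ≡ -1ℤ) where

  private
    k : ℕ
    k = length es

    S : ℕ → ℤ
    S t = sumℤ (take t (es ++ es))

    drift : ∀ t → t ≤ k → S (k + t) ≡ pred (S t)
    drift t t≤k = begin
      sumℤ (take (k + t) (es ++ es))        ≡⟨ cong sumℤ (take-++ (k + t) es es (m≤m+n k t)) ⟩
      sumℤ (es ++ take (k + t ∸ k) es)      ≡⟨ sumℤ-++ es _ ⟩
      sumℤ es ℤ.+ sumℤ (take (k + t ∸ k) es) ≡⟨ cong₂ ℤ._+_ Σes≡-1 (cong (λ s → sumℤ (take s es)) (m+n∸m≡n k t)) ⟩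
      -1ℤ ℤ.+ sumℤ (take t es)               ≡⟨ cong (λ xs → -1ℤ ℤ.+ sumℤ xs) (take-++ˡ t es es t≤k) ⟨
      pred (S t)                             ∎

    window : ∀ i m → i ≤ k → m ≤ k → S (i + m) ≡ S i ℤ.+ sumℤ (take m (cyclicShift i es))
    window i m i≤k m≤k = begin
      S (i + m)                                       ≡⟨ sumℤ-take-+ i m (es ++ es) ⟩
      S i ℤ.+ sumℤ (take m (drop i (es ++ es)))       ≡⟨ cong (λ xs → S i ℤ.+ sumℤ xs) window≡ ⟨
      S i ℤ.+ sumℤ (take m (cyclicShift i es))        ∎
      where
      window≡ : take m (cyclicShift i es) ≡ take m (drop i (es ++ es))
      window≡ = begin
        take m (cyclicShift i es)                  ≡⟨ cong (take m) (cyclicShift-window i es i≤k) ⟩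
        take m (take k (drop i (es ++ es)))        ≡⟨ take-take m k _ ⟩
        take (m ⊓ k) (drop i (es ++ es))           ≡⟨ cong (λ s → take s (drop i (es ++ es))) (m≤n⇒m⊓n≡m m≤k) ⟩
        take m (drop i (es ++ es))                 ∎

    open WalkWithDrift S k drift

    nonnegPrefixes⇒minimalAhead : ∀ {i} → i < k → T (nonnegPrefixes 0ℤ (cyclicShift i es)) → MinimalAhead i
    nonnegPrefixes⇒minimalAhead {i} i<k t m m<k =
      subst (S i ℤ.≤_) (sym (window i m (<⇒≤ i<k) (<⇒≤ m<k)))
        (≤-extendˡ (S i) _ (subst (0ℤ ℤ.≤_) (ℤ.+-identityˡ _)
          (nonnegPrefixes⇒ 0ℤ (cyclicShift i es) ℤ.≤-refl t m (subst (m <_) (sym (length-cyclicShift i es)) m<k))))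

    minimalAhead⇒nonnegPrefixes : ∀ {i} → i < k → MinimalAhead i → T (nonnegPrefixes 0ℤ (cyclicShift i es))
    minimalAhead⇒nonnegPrefixes {i} i<k ahead = ⇒nonnegPrefixes 0ℤ (cyclicShift i es) λ m m<n →
      let m<k = subst (m <_) (length-cyclicShift i es) m<n in
      subst (0ℤ ℤ.≤_) (sym (ℤ.+-identityˡ _))
        (≤-cancelˡ (S i) _ (subst (S i ℤ.≤_) (window i m (<⇒≤ i<k) (<⇒≤ m<k)) (ahead m m<k)))

  cycleLemma : 1 ≤ length es → ∑[ i < length es ] 𝟙 (nonnegPrefixes 0ℤ (cyclicShift i es)) ≡ 1
  cycleLemma k≥1 with minimalAhead-exists k≥1
  ... | i₀ , i₀<k , ahead =
    ∑<-𝟙-unique k _ i₀<k (minimalAhead⇒nonnegPrefixes i₀<k ahead)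
      (λ i<k t → minimalAhead-unique i<k i₀<k (nonnegPrefixes⇒minimalAhead i<k t) ahead)

length-differences : ∀ as cs → length as ≡ length cs → length (differences as cs) ≡ length as
length-differences []       []       _  = refl
length-differences (a ∷ as) (c ∷ cs) eq = cong suc (length-differences as cs (suc-injective eq))

sumℤ-differences : ∀ as cs → length as ≡ length cs → sumℤ (differences as cs) ≡ sum as ⊖ sum cs
sumℤ-differences []       []       _  = refl
sumℤ-differences (a ∷ as) (c ∷ cs) eq = begin
  (a ⊖ c) ℤ.+ sumℤ (differences as cs)
    ≡⟨ cong (λ t → (a ⊖ c) ℤ.+ t) (sumℤ-differences as cs (suc-injective eq)) ⟩
  (a ⊖ c) ℤ.+ (sum as ⊖ sum cs)
    ≡⟨ cong₂ ℤ._+_ (ℤ.[+m]-[+n]≡m⊖n a c) (ℤ.[+m]-[+n]≡m⊖n (sum as) (sum cs)) ⟨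
  (pos a ℤ.- pos c) ℤ.+ (pos (sum as) ℤ.- pos (sum cs))
    ≡⟨ interchange (pos a) (pos c) (pos (sum as)) (pos (sum cs)) ⟩
  (pos a ℤ.+ pos (sum as)) ℤ.- (pos c ℤ.+ pos (sum cs))
    ≡⟨ cong₂ ℤ._-_ (ℤ.pos-+ a (sum as)) (ℤ.pos-+ c (sum cs)) ⟨
  pos (a + sum as) ℤ.- pos (c + sum cs)
    ≡⟨ ℤ.[+m]-[+n]≡m⊖n (a + sum as) (c + sum cs) ⟩
  (a + sum as) ⊖ (c + sum cs) ∎
  where
  interchange : ∀ w x y z → (w ℤ.- x) ℤ.+ (y ℤ.- z) ≡ (w ℤ.+ y) ℤ.- (x ℤ.+ z)
  interchange = ℤ-Solver.solve-∀

n⊖suc[n]≡-1 : ∀ n → n ⊖ suc n ≡ -1ℤ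
n⊖suc[n]≡-1 zero    = refl
n⊖suc[n]≡-1 (suc n) = trans (ℤ.[1+m]⊖[1+n]≡m⊖n n (suc n)) (n⊖suc[n]≡-1 n)

-- Dyck paths with a given rise composition

_≟ₗ_ : DecidableEquality (List ℕ)
_≟ₗ_ = ≡-dec _≟_

dyckWithRise : ℕ → List ℕ → ℕ
dyckWithRise n as = countWords (n + n) (λ w → isDyck w ∧ does (riseComposition w ≟ₗ as))

-- Compositions of n + 1 into k parts satisfying F, each counted through its stars-and-bars word of length n.
#compositions : ℕ → ℕ → (List ℕ → Bool) → ℕ
#compositions n k F = countWords n (λ v → does (downs v ≟ k ∸ 1) ∧ F (wordComposition v))

module RiseCorrespondence {n k : ℕ} (k≥1 : 1 ≤ k) {as : List ℕ}
                          (as⁺ : All (1 ≤_) as) (Σas : sum as ≡ n) (|as| : length as ≡ k) where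

  isDyckWithRise : List Step → Bool
  isDyckWithRise w = isDyck w ∧ does (riseComposition w ≟ₗ as)

  isBallot : List Step → Bool
  isBallot v = does (downs v ≟ k ∸ 1) ∧ nonnegPrefixes 0ℤ (differences as (wordComposition v))

  toPath : List Step → List Step
  toPath v = runWord as (decrementLast (wordComposition v))

  fromPath : List Step → List Step
  fromPath w = compositionWord (incrementLast (descentComposition w))

  toPath-valid : ∀ {v} → length v ≡ n → T (isBallot v) →
                 T (isDyckWithRise (toPath v)) × length (toPath v) ≡ n + n × fromPath (toPath v) ≡ v
  toPath-valid {v} |v| ballot with ∧-elim ballot
  ... | downs≡ , ballot′ =
    ∧-intro dyck (T-does⁺ (_ ≟ₗ as) (riseComposition-runWord runs′)) ,
    trans (length-runWord as c′ (proj₁ runs′)) (cong₂ _+_ Σas Σc′) ,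
    (begin
      compositionWord (incrementLast (descentComposition (runWord as c′)))
        ≡⟨ cong (λ cs → compositionWord (incrementLast cs)) (descentComposition-runWord runs′) ⟩
      compositionWord (incrementLast c′)
        ≡⟨ cong compositionWord (incrementLast-decrementLast c⁺) ⟩
      compositionWord c
        ≡⟨ compositionWord-wordComposition v ⟩
      v ∎)
    where
    c c′ : List ℕ
    c = wordComposition v
    c′ = decrementLast c
    c-comp : IsComposition (suc n) k c
    c-comp = wordComposition-isComposition k≥1 v |v| (T-does⁻ (downs v ≟ k ∸ 1) downs≡)
    c⁺ : All (1 ≤_) c
    c⁺ = proj₁ c-comp
    |c| : length c ≡ k
    |c| = proj₂ (proj₂ c-comp)
    total : 0 + sum as + 1 ≡ sum c
    total = trans (cong (_+ 1) Σas) (trans (+-comm n 1) (sym (proj₁ (proj₂ c-comp))))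
    c′-dyck : All (1 ≤_) c′ × T (dyckFrom 0 (runWord as c′))
    c′-dyck = nonnegPrefixes⇒dyck 0 (trans |as| (sym |c|) , as⁺ , c⁺) (subst (1 ≤_) (sym |as|) k≥1) ballot′ total
    dyck : T (isDyck (runWord as c′))
    dyck = proj₂ c′-dyck
    runs′ : Runs as c′
    runs′ = trans |as| (sym (trans (length-decrementLast c) |c|)) , as⁺ , proj₁ c′-dyck
    Σc′ : sum c′ ≡ n
    Σc′ = suc-injective (trans (suc-sum-decrementLast c⁺ (subst (1 ≤_) (sym |c|) k≥1)) (proj₁ (proj₂ c-comp)))

  private
    fromPath-runWord : ∀ {w bs} → Runs as bs → w ≡ runWord as bs → length w ≡ n + n → T (isDyck w) →
                       T (isBallot (fromPath w)) × length (fromPath w) ≡ n × toPath (fromPath w) ≡ w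
    fromPath-runWord {w} {bs} runs@(|as|≡|bs| , _ , bs⁺) w≡ |w| dyck =
      ∧-intro (T-does⁺ (downs (fromPath w) ≟ k ∸ 1) downs≡) ballot ,
      trans (cong length fromPath≡) (length-compositionWord k≥1 c-comp) ,
      (begin
        runWord as (decrementLast (wordComposition (fromPath w)))
          ≡⟨ cong (λ cs → runWord as (decrementLast cs)) decoded ⟩
        runWord as (decrementLast (incrementLast bs))
          ≡⟨ cong (runWord as) (decrementLast-incrementLast bs) ⟩
        runWord as bs
          ≡⟨ w≡ ⟨
        w ∎)
      where
      |bs| : length bs ≡ k
      |bs| = trans (sym |as|≡|bs|) |as|
      Σbs : sum bs ≡ n
      Σbs = +-cancelˡ-≡ n _ _ (begin
        n + sum bs                 ≡⟨ cong (_+ sum bs) Σas ⟨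
        sum as + sum bs            ≡⟨ length-runWord as bs |as|≡|bs| ⟨
        length (runWord as bs)     ≡⟨ cong length w≡ ⟨
        length w                   ≡⟨ |w| ⟩
        n + n                      ∎)
      c : List ℕ
      c = incrementLast bs
      c-comp : IsComposition (suc n) k c
      c-comp = incrementLast-positive bs⁺ ,
               trans (sum-incrementLast bs (subst (1 ≤_) (sym |bs|) k≥1)) (cong suc Σbs) ,
               trans (length-incrementLast bs) |bs|
      fromPath≡ : fromPath w ≡ compositionWord c
      fromPath≡ = trans (cong (λ v → compositionWord (incrementLast (descentComposition v))) w≡)
                        (cong (λ cs → compositionWord (incrementLast cs)) (descentComposition-runWord runs))
      decoded : wordComposition (fromPath w) ≡ c
      decoded = trans (cong wordComposition fromPath≡) (decode-compositionWord k≥1 c-comp)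
      downs≡ : downs (fromPath w) ≡ k ∸ 1
      downs≡ = trans (cong downs fromPath≡) (downs-compositionWord k≥1 c-comp)
      ballot : T (nonnegPrefixes 0ℤ (differences as (wordComposition (fromPath w))))
      ballot = subst T (sym (trans (cong (λ cs → nonnegPrefixes 0ℤ (differences as cs)) decoded)
                                   (nonnegPrefixes-incrementLast 0ℤ {as} {bs} |as|≡|bs|)))
                       (dyck⇒nonnegPrefixes 0 {as} {bs} |as|≡|bs| (subst (λ u → T (isDyck u)) w≡ dyck))

  fromPath-valid : ∀ {w} → length w ≡ n + n → T (isDyckWithRise w) →
                   T (isBallot (fromPath w)) × length (fromPath w) ≡ n × toPath (fromPath w) ≡ w
  fromPath-valid {w} |w| dyck∧rise with ∧-elim dyck∧rise
  ... | dyck , rise≡ with dyck⇒runWord w dyck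
  ... | as′ , bs , runs , w≡ = fromPath-runWord (subst (λ xs → Runs xs bs) as′≡as runs)
                                                (trans w≡ (cong (λ xs → runWord xs bs) as′≡as)) |w| dyck
    where
    as′≡as : as′ ≡ as
    as′≡as = trans (sym (riseComposition-runWord runs)) (trans (cong riseComposition (sym w≡)) (T-does⁻ (_ ≟ₗ as) rise≡))

dyckWithRise≡#compositions : ∀ {n k as} → 1 ≤ k → IsComposition n k as →
  dyckWithRise n as ≡ #compositions n k (λ cs → nonnegPrefixes 0ℤ (differences as cs))
dyckWithRise≡#compositions k≥1 (as⁺ , Σas , |as|) =
  countWords-bijection isDyckWithRise isBallot toPath fromPath toPath-valid fromPath-valid
  where open RiseCorrespondence k≥1 as⁺ Σas |as|

module _ {n k : ℕ} (k≥1 : 1 ≤ k) where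

  private
    Composition : List ℕ → Set
    Composition = IsComposition (suc n) k

    reencode : (σ τ : List ℕ → List ℕ) (H G : List ℕ → Bool) →
      (∀ {c} → Composition c → Composition (σ c) × τ (σ c) ≡ c) →
      (∀ {c} → Composition c → T (H c) → T (G (σ c))) →
      ∀ {v} → length v ≡ n → T (does (downs v ≟ k ∸ 1) ∧ H (wordComposition v)) →
      let u = compositionWord (σ (wordComposition v)) in
      T (does (downs u ≟ k ∸ 1) ∧ G (wordComposition u)) × length u ≡ n × compositionWord (τ (wordComposition u)) ≡ v
    reencode σ τ H G σ-ok H⇒G {v} |v| t with ∧-elim t
    ... | downs≡ , Hc =
      ∧-intro (T-does⁺ (_ ≟ k ∸ 1) (downs-compositionWord k≥1 σc-comp)) (subst (λ c′ → T (G c′)) (sym decoded) (H⇒G c-comp Hc)) ,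
      length-compositionWord k≥1 σc-comp ,
      (begin
        compositionWord (τ (wordComposition (compositionWord (σ c)))) ≡⟨ cong (λ c′ → compositionWord (τ c′)) decoded ⟩
        compositionWord (τ (σ c))                                   ≡⟨ cong compositionWord (proj₂ (σ-ok c-comp)) ⟩
        compositionWord c                                           ≡⟨ compositionWord-wordComposition v ⟩
        v                                                           ∎)
      where
      c : List ℕ
      c = wordComposition v
      c-comp : Composition c
      c-comp = wordComposition-isComposition k≥1 v |v| (T-does⁻ (downs v ≟ k ∸ 1) downs≡)
      σc-comp : Composition (σ c)
      σc-comp = proj₁ (σ-ok c-comp)
      decoded : wordComposition (compositionWord (σ c)) ≡ σ c
      decoded = decode-compositionWord k≥1 σc-comp

  #compositions-reindex : (F : List ℕ → Bool) (ρ ρ′ : List ℕ → List ℕ) →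
    (∀ {c} → Composition c → Composition (ρ c) × ρ′ (ρ c) ≡ c) →
    (∀ {c} → Composition c → Composition (ρ′ c) × ρ (ρ′ c) ≡ c) →
    #compositions n k F ≡ #compositions n k (λ c → F (ρ c))
  #compositions-reindex F ρ ρ′ ρ-ok ρ′-ok =
    countWords-bijection _ _ (λ v → compositionWord (ρ (wordComposition v)))
                             (λ v → compositionWord (ρ′ (wordComposition v)))
      (reencode ρ ρ′ (λ c → F (ρ c)) F ρ-ok (λ _ Fρc → Fρc))
      (reencode ρ′ ρ F (λ c → F (ρ c)) ρ′-ok
                (λ c-comp Fc → subst (λ c → T (F c)) (sym (proj₂ (ρ′-ok c-comp))) Fc))

  #compositions-rotate : ∀ (F : List ℕ → Bool) {i} → i ≤ k → #compositions n k F ≡ #compositions n k (λ c → F (rotate i c))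
  #compositions-rotate F {i} i≤k =
    #compositions-reindex F (rotate i) (rotate (k ∸ i)) (rotation-ok i (k ∸ i) (m+[n∸m]≡n i≤k))
                                                        (rotation-ok (k ∸ i) i (m∸n+n≡m i≤k))
    where
    rotation-ok : ∀ j j′ → j + j′ ≡ k → ∀ {c} → Composition c → Composition (rotate j c) × rotate j′ (rotate j c) ≡ c
    rotation-ok j j′ j+j′≡k {c} (c⁺ , Σc , |c|) =
      (cyclicShift-All j c⁺ , trans (sum-rotate j c) Σc , trans (length-cyclicShift j c) |c|) ,
      cyclicShift-inverse {i = j′} {j} c (trans (+-comm j′ j) (trans j+j′≡k (sym |c|)))

∑<-ballot-rotate : ∀ {n k μ c} → 1 ≤ k → IsComposition n k μ → IsComposition (suc n) k c →
                   ∑[ i < k ] 𝟙 (nonnegPrefixes 0ℤ (differences (rotate i μ) (rotate i c))) ≡ 1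
∑<-ballot-rotate {n} {k} {μ} {c} k≥1 (_ , Σμ , |μ|) (_ , Σc , |c|) = begin
  ∑[ i < k ] 𝟙 (nonnegPrefixes 0ℤ (differences (rotate i μ) (rotate i c)))
    ≡⟨ ∑<-cong k (λ {i} _ → cong (λ es → 𝟙 (nonnegPrefixes 0ℤ es)) (zipWith-cyclicShift _⊖_ i μ c |μ|≡|c|)) ⟩
  ∑[ i < k ] 𝟙 (nonnegPrefixes 0ℤ (cyclicShift i es))
    ≡⟨ cong (λ t → ∑[ i < t ] 𝟙 (nonnegPrefixes 0ℤ (cyclicShift i es))) |es| ⟨
  ∑[ i < length es ] 𝟙 (nonnegPrefixes 0ℤ (cyclicShift i es))
    ≡⟨ cycleLemma es Σes≡-1 (subst (1 ≤_) (sym |es|) k≥1) ⟩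
  1 ∎
  where
  |μ|≡|c| : length μ ≡ length c
  |μ|≡|c| = trans |μ| (sym |c|)
  es : List ℤ
  es = differences μ c
  |es| : length es ≡ k
  |es| = trans (length-differences μ c |μ|≡|c|) |μ|
  Σes≡-1 : sumℤ es ≡ -1ℤ
  Σes≡-1 = trans (sumℤ-differences μ c |μ|≡|c|) (trans (cong₂ _⊖_ Σμ Σc) (n⊖suc[n]≡-1 n))

∑-dyckWithRise-rotate : ∀ {n k μ} → 1 ≤ k → IsComposition n k μ →
                        ∑[ i < k ] dyckWithRise n (rotate i μ) ≡ n C (k ∸ 1)
∑-dyckWithRise-rotate {n} {k} {μ} k≥1 μ-comp@(μ⁺ , Σμ , |μ|) = begin
  ∑[ i < k ] dyckWithRise n (rotate i μ)
    ≡⟨ ∑<-cong k (λ {i} i<k → trans (dyckWithRise≡#compositions k≥1 (rotate-comp i))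
                                    (#compositions-rotate {n} k≥1 (ballot (rotate i μ)) (<⇒≤ i<k))) ⟩
  ∑[ i < k ] ∑[ v ∈ words n ] 𝟙 (does (downs v ≟ k ∸ 1) ∧ ballot (rotate i μ) (rotate i (wordComposition v)))
    ≡⟨ ∑-∑<-comm (words n) k _ ⟨
  ∑[ v ∈ words n ] ∑[ i < k ] 𝟙 (does (downs v ≟ k ∸ 1) ∧ ballot (rotate i μ) (rotate i (wordComposition v)))
    ≡⟨ ∑-cong (words n) (λ {v} v∈ → exactlyOneRotation v (All.lookup (words-length n) v∈)) ⟩
  countWords n (λ v → does (downs v ≟ k ∸ 1))
    ≡⟨ countWords-downs n (k ∸ 1) ⟩
  n C (k ∸ 1) ∎
  where
  ballot : List ℕ → List ℕ → Bool
  ballot as cs = nonnegPrefixes 0ℤ (differences as cs)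
  rotate-comp : ∀ i → IsComposition n k (rotate i μ)
  rotate-comp i = cyclicShift-All i μ⁺ , trans (sum-rotate i μ) Σμ , trans (length-cyclicShift i μ) |μ|
  exactlyOneRotation : ∀ v → length v ≡ n →
    ∑[ i < k ] 𝟙 (does (downs v ≟ k ∸ 1) ∧ ballot (rotate i μ) (rotate i (wordComposition v))) ≡ 𝟙 (does (downs v ≟ k ∸ 1))
  exactlyOneRotation v |v| with does (downs v ≟ k ∸ 1) in downs?
  ... | false = ∑<-zero k (λ _ → refl)
  ... | true  = ∑<-ballot-rotate k≥1 μ-comp
                  (wordComposition-isComposition k≥1 v |v| (T-does⁻ (downs v ≟ k ∸ 1) (subst T (sym downs?) _)))

-- The orbit of μ under rotation

module _ {A : Set} (_≟_ : DecidableEquality A) where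

  occurrences : A → List A → ℕ
  occurrences y xs = ∑[ x ∈ xs ] 𝟙 (does (y ≟ x))

  occurrences-∉ : ∀ {y xs} → y ∉ xs → occurrences y xs ≡ 0
  occurrences-∉ {y} {xs} y∉xs =
    ∑-zero xs (λ {x} x∈xs → 𝟙-¬T (λ y≟x → y∉xs (subst (_∈ xs) (sym (T-does⁻ (y ≟ x) y≟x)) x∈xs)))

  occurrences-unique : ∀ {y xs} → Unique xs → y ∈ xs → occurrences y xs ≡ 1
  occurrences-unique {y} (y∉ ∷ _) (here refl) = cong₂ _+_ (𝟙-T (T-does⁺ (y ≟ y) refl)) (occurrences-∉ (All¬⇒¬Any y∉))
  occurrences-unique {y} {x ∷ _} (x∉ ∷ u) (there y∈) =
    cong₂ _+_ (𝟙-¬T (λ y≟x → All.lookup x∉ y∈ (sym (T-does⁻ (y ≟ x) y≟x)))) (occurrences-unique u y∈)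

  𝟙-≟-sym : ∀ x y → 𝟙 (does (x ≟ y)) ≡ 𝟙 (does (y ≟ x))
  𝟙-≟-sym x y = 𝟙-cong (λ x≡y → T-does⁺ (y ≟ x) (sym (T-does⁻ (x ≟ y) x≡y)))
                       (λ y≡x → T-does⁺ (x ≟ y) (sym (T-does⁻ (y ≟ x) y≡x)))

  ∑-occurrences : ∀ {ys} xs → Unique ys → (∀ {x} → x ∈ xs → x ∈ ys) → ∑[ y ∈ ys ] occurrences y xs ≡ length xs
  ∑-occurrences {ys} []       _ _    = ∑-zero ys (λ _ → refl)
  ∑-occurrences {ys} (x ∷ xs) u xs⊆ys = begin
    ∑[ y ∈ ys ] (𝟙 (does (y ≟ x)) + occurrences y xs)   ≡⟨ ∑-+ ys _ _ ⟩
    ∑[ y ∈ ys ] 𝟙 (does (y ≟ x)) + ∑[ y ∈ ys ] occurrences y xs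
      ≡⟨ cong (_+ ∑[ y ∈ ys ] occurrences y xs) (∑-cong ys (λ {y} _ → 𝟙-≟-sym y x)) ⟩
    occurrences x ys + ∑[ y ∈ ys ] occurrences y xs
      ≡⟨ cong₂ _+_ (occurrences-unique u (xs⊆ys (here refl))) (∑-occurrences xs u (λ x∈ → xs⊆ys (there x∈))) ⟩
    suc (length xs) ∎

  length≡|deduplicate|*occurrences : ∀ xs {m} → (∀ {x} → x ∈ xs → occurrences x xs ≡ m) →
                                     length xs ≡ length (deduplicate _≟_ xs) * m
  length≡|deduplicate|*occurrences xs {m} uniform = begin
    length xs
      ≡⟨ ∑-occurrences xs (deduplicate-! _≟_ xs) (∈-deduplicate⁺ _≟_) ⟨
    ∑[ y ∈ deduplicate _≟_ xs ] occurrences y xs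
      ≡⟨ ∑-cong (deduplicate _≟_ xs) (λ y∈ → uniform (∈-deduplicate⁻ _≟_ xs y∈)) ⟩
    ∑[ y ∈ deduplicate _≟_ xs ] m
      ≡⟨ ∑-const (deduplicate _≟_ xs) m ⟩
    length (deduplicate _≟_ xs) * m ∎

multiplicity : List ℕ → List ℕ → ℕ
multiplicity μ ν = ∑[ i < length μ ] 𝟙 (does (ν ≟ₗ rotate i μ))

occurrences-rotations : ∀ μ ν → occurrences _≟ₗ_ ν (rotations μ) ≡ multiplicity μ ν
occurrences-rotations μ ν = trans (∑-map (λ i → rotate i μ) (upTo (length μ)) _) (∑-upTo (length μ) _)

∈-rotations⁻ : ∀ {μ ν} → ν ∈ rotations μ → ∃[ j ] j < length μ × ν ≡ rotate j μ
∈-rotations⁻ ν∈ with ∈-map⁻ _ ν∈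
... | j , j∈ , ν≡ = j , ∈-upTo⁻ j∈ , ν≡

-- With s = k − j, rotate j μ = rotate i μ iff μ = rotate (s + i) μ, and i ↦ s + i permutes the residues mod k.
multiplicity-rotate : ∀ μ {j} → j ≤ length μ → multiplicity μ (rotate j μ) ≡ multiplicity μ μ
multiplicity-rotate μ {j} j≤k = begin
  ∑[ i < k ] 𝟙 (does (rotate j μ ≟ₗ rotate i μ))
    ≡⟨ ∑<-cong k (λ {i} i<k → 𝟙-cong (fwd i<k) (bwd i<k)) ⟩
  ∑[ i < k ] fixed (s + i)
    ≡⟨ ∑<-periodic k fixed (λ t → cong (λ xs → 𝟙 (does (μ ≟ₗ xs))) (shift₁^-periodic t μ)) s ⟩
  ∑[ i < k ] fixed i
    ≡⟨ ∑<-cong k (λ {i} i<k → cong (λ xs → 𝟙 (does (μ ≟ₗ xs))) (cyclicShift≡shift₁^ i μ (<⇒≤ i<k))) ⟨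
  multiplicity μ μ ∎
  where
  k s : ℕ
  k = length μ
  s = k ∸ j
  s+j≡k : s + j ≡ k
  s+j≡k = m∸n+n≡m j≤k
  fixed : ℕ → ℕ
  fixed t = 𝟙 (does (μ ≟ₗ shift₁^ t μ))
  fwd : ∀ {i} → i < k → T (does (rotate j μ ≟ₗ rotate i μ)) → T (does (μ ≟ₗ shift₁^ (s + i) μ))
  fwd {i} i<k t = T-does⁺ (μ ≟ₗ _) (begin
    μ
      ≡⟨ shift₁^-length μ ⟨
    shift₁^ k μ
      ≡⟨ cong (λ t → shift₁^ t μ) s+j≡k ⟨
    shift₁^ (s + j) μ
      ≡⟨ shift₁^-+ s j μ ⟩
    shift₁^ s (shift₁^ j μ)
      ≡⟨ cong (shift₁^ s) (trans (sym (cyclicShift≡shift₁^ j μ j≤k))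
                                 (trans (T-does⁻ (_ ≟ₗ _) t) (cyclicShift≡shift₁^ i μ (<⇒≤ i<k)))) ⟩
    shift₁^ s (shift₁^ i μ)
      ≡⟨ shift₁^-+ s i μ ⟨
    shift₁^ (s + i) μ ∎)
  bwd : ∀ {i} → i < k → T (does (μ ≟ₗ shift₁^ (s + i) μ)) → T (does (rotate j μ ≟ₗ rotate i μ))
  bwd {i} i<k t = T-does⁺ (_ ≟ₗ _) (begin
    rotate j μ
      ≡⟨ cyclicShift≡shift₁^ j μ j≤k ⟩
    shift₁^ j μ
      ≡⟨ cong (shift₁^ j) (T-does⁻ (μ ≟ₗ _) t) ⟩
    shift₁^ j (shift₁^ (s + i) μ)
      ≡⟨ shift₁^-+ j (s + i) μ ⟨
    shift₁^ (j + (s + i)) μ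
      ≡⟨ cong (λ t → shift₁^ t μ) (trans (sym (+-assoc j s i)) (cong (_+ i) (trans (+-comm j s) s+j≡k))) ⟩
    shift₁^ (k + i) μ
      ≡⟨ shift₁^-periodic i μ ⟩
    shift₁^ i μ
      ≡⟨ cyclicShift≡shift₁^ i μ (<⇒≤ i<k) ⟨
    rotate i μ ∎)

-- Orbit–stabiliser count: every composition in [μ] arises from the same number of the k rotations.
length*𝟙∈Cyc≡ord*multiplicity : ∀ μ ν → length μ * 𝟙 (does (ν ∈Cyc? μ)) ≡ ord μ * multiplicity μ ν
length*𝟙∈Cyc≡ord*multiplicity μ ν with ν ∈Cyc? μ
... | yes ν∈ = let j , j<k , ν≡ = ∈-rotations⁻ ν∈ in begin
  length μ * 1                ≡⟨ *-identityʳ (length μ) ⟩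
  length μ                    ≡⟨ length-rotations ⟨
  length (rotations μ)        ≡⟨ length≡|deduplicate|*occurrences _≟ₗ_ (rotations μ) uniform ⟩
  ord μ * multiplicity μ μ    ≡⟨ cong (ord μ *_) (trans (cong (multiplicity μ) ν≡) (multiplicity-rotate μ (<⇒≤ j<k))) ⟨
  ord μ * multiplicity μ ν    ∎
  where
  length-rotations : length (rotations μ) ≡ length μ
  length-rotations = trans (length-map _ (upTo (length μ))) (length-upTo (length μ))
  uniform : ∀ {x} → x ∈ rotations μ → occurrences _≟ₗ_ x (rotations μ) ≡ multiplicity μ μ
  uniform {x} x∈ = let j , j<k , x≡ = ∈-rotations⁻ x∈ in
    trans (occurrences-rotations μ x) (trans (cong (multiplicity μ) x≡) (multiplicity-rotate μ (<⇒≤ j<k)))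
... | no ν∉ = begin
  length μ * 0                ≡⟨ *-zeroʳ (length μ) ⟩
  0                           ≡⟨ *-zeroʳ (ord μ) ⟨
  ord μ * 0                   ≡⟨ cong (ord μ *_) (trans (sym (occurrences-rotations μ ν)) (occurrences-∉ _≟ₗ_ ν∉)) ⟨
  ord μ * multiplicity μ ν    ∎

countCyc≡∑ : ∀ n μ → countCyc n μ ≡ ∑[ w ∈ words (n + n) ] 𝟙 (isDyck w) * 𝟙 (does (riseComposition w ∈Cyc? μ))
countCyc≡∑ n μ = trans (length-filter≡∑ (λ w → riseComposition w ∈Cyc? μ) (dyckPaths n))
                       (∑-filter (λ w → T? (isDyck w)) (words (n + n)) _)

length*countCyc≡ord*∑ : ∀ n μ → length μ * countCyc n μ
                          ≡ ord μ * (∑[ w ∈ words (n + n) ] 𝟙 (isDyck w) * multiplicity μ (riseComposition w))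
length*countCyc≡ord*∑ n μ =
  trans (cong (length μ *_) (countCyc≡∑ n μ)) (∑-scale (length μ) (ord μ) (words (n + n)) (λ {w} _ → weighted w))
  where
  weighted : ∀ w → length μ * (𝟙 (isDyck w) * 𝟙 (does (riseComposition w ∈Cyc? μ)))
                   ≡ ord μ * (𝟙 (isDyck w) * multiplicity μ (riseComposition w))
  weighted w = begin
    length μ * (𝟙 (isDyck w) * 𝟙 (does (ν ∈Cyc? μ)))   ≡⟨ *-left-comm (length μ) (𝟙 (isDyck w)) _ ⟩
    𝟙 (isDyck w) * (length μ * 𝟙 (does (ν ∈Cyc? μ)))   ≡⟨ cong (𝟙 (isDyck w) *_) (length*𝟙∈Cyc≡ord*multiplicity μ ν) ⟩
    𝟙 (isDyck w) * (ord μ * multiplicity μ ν)          ≡⟨ *-left-comm (𝟙 (isDyck w)) (ord μ) _ ⟩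
    ord μ * (𝟙 (isDyck w) * multiplicity μ ν)          ∎
    where
    ν : List ℕ
    ν = riseComposition w
    *-left-comm : ∀ x y z → x * (y * z) ≡ y * (x * z)
    *-left-comm = solve-∀

∑-dyck*multiplicity : ∀ n μ → ∑[ w ∈ words (n + n) ] 𝟙 (isDyck w) * multiplicity μ (riseComposition w)
                             ≡ ∑[ i < length μ ] dyckWithRise n (rotate i μ)
∑-dyck*multiplicity n μ = begin
  ∑[ w ∈ W ] 𝟙 (isDyck w) * multiplicity μ (riseComposition w)
    ≡⟨ ∑-cong W (λ {w} _ → trans (∑<-*ˡ (𝟙 (isDyck w)) (length μ) _)
                                 (∑<-cong (length μ) (λ _ → sym (𝟙-∧ (isDyck w) _)))) ⟩
  ∑[ w ∈ W ] ∑[ i < length μ ] 𝟙 (isDyck w ∧ does (riseComposition w ≟ₗ rotate i μ))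
    ≡⟨ ∑-∑<-comm W (length μ) _ ⟩
  ∑[ i < length μ ] dyckWithRise n (rotate i μ) ∎
  where
  W : List (List Step)
  W = words (n + n)

-- The hypothesis k ≤ n is implied by IsComposition n k μ.
lemma5p2 : (n k : ℕ) → 1 ≤ k → k ≤ n → (μ : List ℕ) → IsComposition n k μ →
    k * countCyc n μ ≡ ord μ * (n C (k ∸ 1))
lemma5p2 n .(length μ) k≥1 _ μ μ-comp@(_ , _ , refl) = begin
  length μ * countCyc n μ
    ≡⟨ length*countCyc≡ord*∑ n μ ⟩
  ord μ * (∑[ w ∈ words (n + n) ] 𝟙 (isDyck w) * multiplicity μ (riseComposition w))
    ≡⟨ cong (ord μ *_) (∑-dyck*multiplicity n μ) ⟩
  ord μ * (∑[ i < length μ ] dyckWithRise n (rotate i μ))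
    ≡⟨ cong (ord μ *_) (∑-dyckWithRise-rotate k≥1 μ-comp) ⟩
  ord μ * (n C (length μ ∸ 1)) ∎
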